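{- Let $\mathcal{G}$ be the class of all finite acyclic undirected simple graphs in which no two vertices of degree greater than $2$ are adjacent. Then $\mathcal{G}$ has the weak amalgamation property.
   Context: Embeddings between graphs are injective maps preserving and reflecting adjacency (isomorphisms onto induced subgraphs). A class $\mathcal{F}$ of finite structures has the weak amalgamation property (WAP) if for every $Z\in\mathcal{F}$ there is $Z'\in\mathcal{F}$ containing $Z$ as a substructure such that for all embeddings $f\colon Z'\to X$, $g\colon Z'\to Y$ with $X,Y\in\mathcal{F}$ there exist $W\in\mathcal{F}$ and embeddings $f'\colon X\to W$, $g'\colon Y\to W$ with $f'\circ f\restriction Z=g'\circ g\restriction Z$. -}

module Defs where

open import Data.Nat using (ℕ; suc; _>_; _≤_)
open import Data.Fin using (Fin)
open import Data.Bool using (Bool; true; false)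
open import Data.List using (List; []; _∷_; length; filter; head; last)
open import Data.List.Relation.Unary.Unique.Propositional using (Unique)
open import Data.List.Relation.Unary.Linked using (Linked)
open import Data.List.Relation.Unary.All using (All)
open import Data.Empty using (⊥)
open import Data.Maybe using (Maybe; just; nothing)
open import Data.Fin.Base using ()
open import Data.List using (allFin)
open import Data.Product using (Σ; _×_; ∃-syntax)
open import Relation.Binary.PropositionalEquality using (_≡_)
open import Relation.Nullary using (¬_)
open import Relation.Nullary.Decidable using (Dec)
open import Data.Bool using (_≟_)
open import Function.Definitions using (Injective)

record Graph : Set where
  field
    size  : ℕ
    adj   : Fin size → Fin size → Bool
    irrefl : ∀ i → adj i i ≡ false
    sym    : ∀ i j → adj i j ≡ adj j i
open Graph public

Adj : (G : Graph) → Fin (size G) → Fin (size G) → Set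
Adj G i j = adj G i j ≡ true

degree : (G : Graph) → Fin (size G) → ℕ
degree G v = length (filter (λ w → adj G v w ≟ true) (allFin (size G)))

IsCycle : (G : Graph) → List (Fin (size G)) → Set
IsCycle G vs =
  (3 ≤ length vs) × Unique vs × Linked (Adj G) vs ×
  (∀ a b → head vs ≡ just a → last vs ≡ just b → Adj G b a)

Acyclic : Graph → Set
Acyclic G = ∀ vs → ¬ IsCycle G vs

NoAdjacentBranching : Graph → Set
NoAdjacentBranching G =
  ∀ i j → Adj G i j → degree G i > 2 → degree G j > 2 → ⊥

InG : Graph → Set
InG G = Acyclic G × NoAdjacentBranching G

record Embedding (G H : Graph) : Set where
  field
    map : Fin (size G) → Fin (size H)
    injective : Injective _≡_ _≡_ map
    preserves : ∀ i j → adj H (map i) (map j) ≡ adj G i j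
open Embedding public

_∘ᵉ_ : ∀ {G H K} → Embedding H K → Embedding G H → Embedding G K
_∘ᵉ_ {G} {H} {K} e f = record
  { map = λ i → map e (map f i)
  ; injective = λ p → injective f (injective e p)
  ; preserves = λ i j → Relation.Binary.PropositionalEquality.trans
      (preserves e (map f i) (map f j)) (preserves f i j) }
  where import Relation.Binary.PropositionalEquality

WAP : (Graph → Set) → Set
WAP P =
  ∀ Z → P Z →
  Σ Graph λ Z' → P Z' × Σ (Embedding Z Z') λ ι →
    ∀ X Y → P X → P Y → (f : Embedding Z' X) (g : Embedding Z' Y) →
    Σ Graph λ W → P W × Σ (Embedding X W) λ f' → Σ (Embedding Y W) λ g' →
      ∀ z → map f' (map f (map ι z)) ≡ map g' (map g (map ι z))

module Submission where

-- Given Z in 𝒢, choose an independent set of "centres" of Z that contains every vertex of degree ≥ 3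
-- and dominates Z.  Z′ gives each centre three new leaves, each non-centre of degree 1 a new
-- neighbour with two leaves, and joins one centre of every component of Z through a connector to a
-- new hub with three leaves.  The set S of old vertices, new neighbours, connectors and hub is
-- connected in Z′, and each of its vertices either has degree ≥ 3 or is saturated: it has two
-- neighbours in S and a neighbour of degree ≥ 3.  In any X ⊇ Z′ in 𝒢 a saturated vertex is then
-- next to a branch vertex, so it keeps exactly its two neighbours from S.
--
-- Given X, Y ⊇ Z′, glue X and Y along S.  Saturated vertices gain no neighbours, so no two branch
-- vertices become adjacent.  A cycle of the glued graph that is not inside X or Y enters the
-- X-only part through S and leaves it through S; closing it up along a path in S gives a cycle in X.

open import Defs renaming (sym to adj-sym; map to embed)

open import Data.Bool using (true; false) renaming (_≟_ to _≟ᵇ_)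
open import Data.Empty using (⊥)
open import Data.Fin using (Fin; toℕ)
open import Data.Fin.Patterns using (0F; 1F; 2F)
open import Data.Fin.Properties
  using (any?; pigeonhole; toℕ<n; toℕ-injective; +↔⊎; *↔×; 1↔⊤; inj⇒≟) renaming (_≟_ to _≟ᶠ_)
open import Data.List using (List; []; _∷_; _++_; length; filter; allFin; map; head; last)
open import Data.List.Properties using (length-++; length-map)
open import Data.List.Membership.Propositional using (_∈_)
open import Data.List.Membership.Propositional.Properties
  using (∈-∃++; ∈-++⁻; ∈-++⁺ˡ; ∈-++⁺ʳ; ∈-filter⁺; ∈-filter⁻; ∈-allFin; ∈-map⁺)
open import Data.List.Relation.Unary.All as All using (All; []; _∷_)
open import Data.List.Relation.Unary.AllPairs using ([]; _∷_)
open import Data.List.Relation.Unary.Any using (here; there)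
open import Data.List.Relation.Unary.Linked using (Linked; []; [-]; _∷_)
open import Data.List.Relation.Unary.Unique.Propositional using (Unique)
import Data.List.Relation.Unary.Unique.Propositional.Properties as Unique
open import Data.Maybe using (just)
open import Data.Maybe.Properties using (just-injective)
open import Data.Nat using (ℕ; zero; suc; _+_; _*_; _∸_; _≤_; _<_; z≤n; s≤s; _≤?_; _<?_; _%_; _/_)
open import Data.Nat.DivMod using (m≡m%n+[m/n]*n; m%n<n; [m+n]%n≡m%n; [m+kn]%n≡m%n; n%n≡0; m<n⇒m%n≡m)
open import Data.Nat.Properties
open import Data.Product using (Σ; _×_; _,_; proj₁; proj₂)
open import Data.Sum using (_⊎_; inj₁; inj₂)
open import Data.Sum.Function.Propositional using (_⊎-↔_)
open import Data.Sum.Properties using (inj₁-injective; inj₂-injective)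
open import Data.Unit using (⊤; tt)
open import Function.Bundles using (_↔_; Inverse)
open import Function.Properties.Inverse using (↔-refl; ↔-sym; ↔-trans; ↔⇒↣)
open import Relation.Binary.Definitions using (DecidableEquality; tri<; tri≈; tri>)
open import Relation.Binary.PropositionalEquality
open import Relation.Nullary using (¬_; Dec; yes; no; does; contradiction; ¬?; _×-dec_; _⊎-dec_)
open import Relation.Nullary.Decidable using (dec-true; dec-false; does-≡; map′; decidable-stable)

least-witness : {P : ℕ → Set} → (∀ n → Dec (P n)) → ∀ {b} → P b →
                Σ ℕ λ m → m ≤ b × P m × (∀ {k} → k < m → ¬ P k)
least-witness P? {zero} pb = zero , z≤n , pb , λ ()
least-witness P? {suc b} pb with P? zero
... | yes p0 = zero , z≤n , p0 , λ ()
... | no ¬p0 with least-witness (λ n → P? (suc n)) pb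
...   | m , m≤b , pm , below = suc m , s≤s m≤b , pm , λ { {zero} _ → ¬p0 ; {suc k} (s≤s k<m) → below k<m }

first-after : {Q : ℕ → Set} → (∀ n → Dec (Q n)) → ∀ a {m} → a < m → Q m →
              Σ ℕ λ j → a < j × Q j × (∀ {k} → a < k → k < j → ¬ Q k)
first-after {Q} Q? a {m} a<m Qm
  with t , _ , Qt , first ← least-witness (λ t → Q? (suc a + t)) (subst Q (sym (m+[n∸m]≡n a<m)) Qm) =
  suc a + t , s≤s (m≤m+n a t) , Qt ,
  λ {k} a<k k<j → subst (λ z → ¬ Q z) (m+[n∸m]≡n a<k) (first (+-cancelˡ-< (suc a) _ _ (subst (_< suc a + t) (sym (m+[n∸m]≡n a<k)) k<j)))

length-≤-injectiveOn : {A B : Set} {xs : List A} {ys : List B} (h : A → B) → Unique xs →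
                       (∀ {x} → x ∈ xs → h x ∈ ys) →
                       (∀ {x x'} → x ∈ xs → x' ∈ xs → h x ≡ h x' → x ≡ x') →
                       length xs ≤ length ys
length-≤-injectiveOn {xs = []} h _ _ _ = z≤n
length-≤-injectiveOn {xs = x ∷ xs} {ys} h (x∉xs ∷ uniq) into inj
  with pre , post , refl ← ∈-∃++ (into (here refl)) =
  subst (suc (length xs) ≤_) (sym length-pre++x∷post)
    (s≤s (length-≤-injectiveOn h uniq into′ λ p p' → inj (there p) (there p')))
  where
  length-pre++x∷post : length (pre ++ h x ∷ post) ≡ suc (length (pre ++ post))
  length-pre++x∷post = begin
    length (pre ++ h x ∷ post)      ≡⟨ length-++ pre ⟩
    length pre + suc (length post)  ≡⟨ +-suc (length pre) (length post) ⟩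
    suc (length pre + length post)  ≡⟨ cong suc (length-++ pre) ⟨
    suc (length (pre ++ post))      ∎
    where open ≡-Reasoning
  into′ : ∀ {x'} → x' ∈ xs → h x' ∈ pre ++ post
  into′ {x'} x'∈xs with ∈-++⁻ pre (into (there x'∈xs))
  ... | inj₁ p = ∈-++⁺ˡ p
  ... | inj₂ (there p) = ∈-++⁺ʳ pre p
  ... | inj₂ (here hx'≡hx) =
    contradiction (inj (here refl) (there x'∈xs) (sym hx'≡hx)) (All.lookup x∉xs x'∈xs)

two-elements : ∀ {A : Set} {xs : List A} → length xs ≡ 2 → Unique xs → Σ A λ x → Σ A λ y → x ≢ y × x ∈ xs × y ∈ xs
two-elements {xs = x ∷ y ∷ []} _ ((x≢y ∷ []) ∷ _) = x , y , x≢y , here refl , there (here refl)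

Vtx : Graph → Set
Vtx G = Fin (size G)

module _ (G : Graph) where

  Adj? : (u v : Vtx G) → Dec (Adj G u v)
  Adj? u v = adj G u v ≟ᵇ true

  Adj-irrefl : ∀ {u} → ¬ Adj G u u
  Adj-irrefl {u} e = contradiction (trans (sym e) (irrefl G u)) λ ()

  Adj-sym : ∀ {u v} → Adj G u v → Adj G v u
  Adj-sym {u} {v} = trans (adj-sym G v u)

  neighbours : Vtx G → List (Vtx G)
  neighbours v = filter (Adj? v) (allFin (size G))

  neighbours-unique : ∀ v → Unique (neighbours v)
  neighbours-unique v = Unique.filter⁺ (Adj? v) (Unique.allFin⁺ (size G))

  ∈-neighbours⁺ : ∀ {v u} → Adj G v u → u ∈ neighbours v
  ∈-neighbours⁺ {v} {u} = ∈-filter⁺ (Adj? v) (∈-allFin u)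

  ∈-neighbours⁻ : ∀ {v u} → u ∈ neighbours v → Adj G v u
  ∈-neighbours⁻ {v} u∈ = proj₂ (∈-filter⁻ (Adj? v) {xs = allFin (size G)} u∈)

degree-≤-degree : ∀ G H {v w} (h : Vtx G → Vtx H) →
                  (∀ {u} → Adj G v u → Adj H w (h u)) →
                  (∀ {u u'} → Adj G v u → Adj G v u' → h u ≡ h u' → u ≡ u') →
                  degree G v ≤ degree H w
degree-≤-degree G H {v} h hom inj =
  length-≤-injectiveOn h (neighbours-unique G v)
    (λ u∈ → ∈-neighbours⁺ H (hom (∈-neighbours⁻ G u∈)))
    (λ u∈ u'∈ → inj (∈-neighbours⁻ G u∈) (∈-neighbours⁻ G u'∈))

degree-≤-length : ∀ G {v} (ys : List (Vtx G)) → (∀ {u} → Adj G v u → u ∈ ys) → degree G v ≤ length ys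
degree-≤-length G {v} ys into =
  length-≤-injectiveOn (λ u → u) (neighbours-unique G v) (λ u∈ → into (∈-neighbours⁻ G u∈)) (λ _ _ eq → eq)

length-≤-degree : ∀ G {v} (xs : List (Vtx G)) → Unique xs → (∀ {u} → u ∈ xs → Adj G v u) → length xs ≤ degree G v
length-≤-degree G xs uniq adjacent =
  length-≤-injectiveOn (λ u → u) uniq (λ u∈ → ∈-neighbours⁺ G (adjacent u∈)) (λ _ _ eq → eq)

3≤degree : ∀ G {v a b c} → Adj G v a → Adj G v b → Adj G v c → a ≢ b → a ≢ c → b ≢ c → 3 ≤ degree G v
3≤degree G va vb vc a≢b a≢c b≢c =
  length-≤-degree G (_ ∷ _ ∷ _ ∷ []) ((a≢b ∷ a≢c ∷ []) ∷ (b≢c ∷ []) ∷ [] ∷ [])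
    λ { (here refl) → va ; (there (here refl)) → vb ; (there (there (here refl))) → vc }

degree≤2⇒neighbour : ∀ G {v a b u} → degree G v ≤ 2 → Adj G v a → Adj G v b → a ≢ b → Adj G v u →
                     u ≡ a ⊎ u ≡ b
degree≤2⇒neighbour G {a = a} {b} {u} deg≤2 va vb a≢b vu with u ≟ᶠ a | u ≟ᶠ b
... | yes u≡a | _ = inj₁ u≡a
... | no _ | yes u≡b = inj₂ u≡b
... | no u≢a | no u≢b = contradiction (3≤degree G vu va vb u≢a u≢b a≢b) (<⇒≱ (s≤s deg≤2))

module _ {G H : Graph} (e : Embedding G H) where

  Adj-embed : ∀ {u v} → Adj G u v → Adj H (embed e u) (embed e v)
  Adj-embed {u} {v} = trans (preserves e u v)

  Adj-embed⁻ : ∀ {u v} → Adj H (embed e u) (embed e v) → Adj G u v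
  Adj-embed⁻ {u} {v} = trans (sym (preserves e u v))

  degree-≤-embed : ∀ v → degree G v ≤ degree H (embed e v)
  degree-≤-embed v = degree-≤-degree G H (embed e) Adj-embed (λ _ _ → injective e)

-- Walks

record Walk {A : Set} (R : A → A → Set) (P : A → Set) (a b : A) : Set where
  field
    at     : ℕ → A
    len    : ℕ
    at-0   : at 0 ≡ a
    at-len : at len ≡ b
    step   : ∀ i → i < len → R (at i) (at (suc i))
    within : ∀ i → i ≤ len → P (at i)

  NonBacktracking : Set
  NonBacktracking = ∀ i → suc i < len → at i ≢ at (suc (suc i))
open Walk public

splice : {A : Set} → ℕ → (ℕ → A) → (ℕ → A) → ℕ → A
splice k f g t with t ≤? k
... | yes _ = f t
... | no _ = g t

splice-≤ : {A : Set} {k t : ℕ} (f g : ℕ → A) → t ≤ k → splice k f g t ≡ f t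
splice-≤ {k = k} {t} f g t≤k with t ≤? k
... | yes _ = refl
... | no t≰k = contradiction t≤k t≰k

module _ {A : Set} {R : A → A → Set} {P : A → Set} where

  stay : ∀ {a} → P a → Walk R P a a
  stay {a} pa = record
    { at = λ _ → a ; len = 0 ; at-0 = refl ; at-len = refl ; step = λ _ () ; within = λ _ _ → pa }

  hop : ∀ {a b} → P a → P b → R a b → Walk R P a b
  hop {a} {b} pa pb r = record
    { at = λ { zero → a ; (suc _) → b } ; len = 1 ; at-0 = refl ; at-len = refl
    ; step = λ { zero _ → r ; (suc _) (s≤s ()) }
    ; within = λ { zero _ → pa ; (suc _) _ → pb } }

  module Concat {a b c} (W₁ : Walk R P a b) (W₂ : Walk R P b c) where
    l₁ : ℕ
    l₁ = len W₁

    joined : ℕ → A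
    joined = splice l₁ (at W₁) (λ t → at W₂ (t ∸ l₁))

    joined-≤ : ∀ {t} → t ≤ l₁ → joined t ≡ at W₁ t
    joined-≤ = splice-≤ (at W₁) _

    joined-≥ : ∀ {t} → l₁ ≤ t → joined t ≡ at W₂ (t ∸ l₁)
    joined-≥ {t} l₁≤t with t ≤? l₁
    ... | no _ = refl
    ... | yes t≤l₁ with refl ← ≤-antisym t≤l₁ l₁≤t =
      trans (at-len W₁) (trans (sym (at-0 W₂)) (cong (at W₂) (sym (n∸n≡0 l₁))))

    joined-step : ∀ i → i < l₁ + len W₂ → R (joined i) (joined (suc i))
    joined-step i i< = case (suc i ≤? l₁)
      where
      case : Dec (suc i ≤ l₁) → R (joined i) (joined (suc i))
      case (yes si≤l₁) = subst₂ R (sym (joined-≤ (<⇒≤ si≤l₁))) (sym (joined-≤ si≤l₁)) (step W₁ i si≤l₁)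
      case (no si≰l₁) =
        subst₂ R (sym (joined-≥ l₁≤i)) (sym (trans (joined-≥ (m≤n⇒m≤1+n l₁≤i)) (cong (at W₂) (+-∸-assoc 1 l₁≤i))))
          (step W₂ (i ∸ l₁) (subst (i ∸ l₁ <_) (m+n∸m≡n l₁ (len W₂)) (∸-monoˡ-< i< l₁≤i)))
        where
        l₁≤i : l₁ ≤ i
        l₁≤i = ≤-pred (≰⇒> si≰l₁)

    joined-within : ∀ i → i ≤ l₁ + len W₂ → P (joined i)
    joined-within i i≤ with i ≤? l₁
    ... | yes i≤l₁ = within W₁ i i≤l₁
    ... | no _ = within W₂ (i ∸ l₁) (subst (i ∸ l₁ ≤_) (m+n∸m≡n l₁ (len W₂)) (∸-monoˡ-≤ l₁ i≤))

    walk : Walk R P a c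
    walk = record
      { at = joined ; len = l₁ + len W₂
      ; at-0 = trans (joined-≤ z≤n) (at-0 W₁)
      ; at-len = trans (joined-≥ (m≤m+n l₁ _)) (trans (cong (at W₂) (m+n∸m≡n l₁ (len W₂))) (at-len W₂))
      ; step = joined-step ; within = joined-within }

    nonBacktracking : NonBacktracking W₁ → NonBacktracking W₂ →
                      (0 < l₁ → 0 < len W₂ → at W₁ (l₁ ∸ 1) ≢ at W₂ 1) → NonBacktracking walk
    nonBacktracking nb₁ nb₂ junction i si< = case (suc (suc i) ≤? l₁) (l₁ ≤? i)
      where
      case : Dec (suc (suc i) ≤ l₁) → Dec (l₁ ≤ i) → joined i ≢ joined (suc (suc i))
      case (yes ssi≤l₁) _ eq =
        nb₁ i ssi≤l₁ (trans (sym (joined-≤ (<⇒≤ (<⇒≤ ssi≤l₁)))) (trans eq (joined-≤ ssi≤l₁)))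
      case (no _) (yes l₁≤i) eq =
        nb₂ (i ∸ l₁) (subst (suc (i ∸ l₁) <_) (m+n∸m≡n l₁ (len W₂))
                       (subst (_< l₁ + len W₂ ∸ l₁) (+-∸-assoc 1 l₁≤i) (∸-monoˡ-< si< (m≤n⇒m≤1+n l₁≤i))))
          (trans (sym (joined-≥ l₁≤i)) (trans eq (trans (joined-≥ (m≤n⇒m≤1+n (m≤n⇒m≤1+n l₁≤i)))
            (cong (at W₂) (trans (+-∸-assoc 1 (m≤n⇒m≤1+n l₁≤i)) (cong suc (+-∸-assoc 1 l₁≤i)))))))
      case (no ssi≰l₁) (no l₁≰i) eq with refl ← ≤-antisym (≤-pred (≰⇒> ssi≰l₁)) (≰⇒> l₁≰i) =
        junction (s≤s z≤n) (+-cancelˡ-< (suc i) 0 (len W₂) (subst (_< suc i + len W₂) (sym (+-identityʳ (suc i))) si<))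
          (trans (sym (joined-≤ (n≤1+n i))) (trans eq (trans (joined-≥ (n≤1+n (suc i))) (cong (at W₂) (m+n∸n≡m 1 (suc i))))))

  _++ʷ_ : ∀ {a b c} → Walk R P a b → Walk R P b c → Walk R P a c
  W₁ ++ʷ W₂ = Concat.walk W₁ W₂

  ++ʷ-nonBacktracking : ∀ {a b c} (W₁ : Walk R P a b) (W₂ : Walk R P b c) → NonBacktracking W₁ → NonBacktracking W₂ →
                        (0 < len W₁ → 0 < len W₂ → at W₁ (len W₁ ∸ 1) ≢ at W₂ 1) → NonBacktracking (W₁ ++ʷ W₂)
  ++ʷ-nonBacktracking = Concat.nonBacktracking

  reverse : (∀ {x y} → R x y → R y x) → ∀ {a b} → Walk R P a b → Walk R P b a
  reverse R-sym W = record
    { at = λ t → at W (len W ∸ t) ; len = len W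
    ; at-0 = at-len W ; at-len = trans (cong (at W) (n∸n≡0 (len W))) (at-0 W)
    ; step = λ i i< → R-sym (subst (λ z → R (at W (len W ∸ suc i)) (at W z)) (sym (+-∸-assoc 1 i<))
                              (step W (len W ∸ suc i) (∸-monoʳ-< (s≤s z≤n) i<)))
    ; within = λ i _ → within W _ (m∸n≤m (len W) i) }

  retarget : ∀ {a a' b b'} → a ≡ a' → b ≡ b' → Walk R P a b → Walk R P a' b'
  retarget p q W = record
    { at = at W ; len = len W ; at-0 = trans (at-0 W) p ; at-len = trans (at-len W) q
    ; step = step W ; within = within W }

  module Shortcut {a b} (W : Walk R P a b) (k m : ℕ) (len≡ : len W ≡ suc (suc m)) (k≤m : k ≤ m)
                  (backtrack : at W k ≡ at W (suc (suc k))) where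
    skip : ℕ → A
    skip = splice k (at W) (λ t → at W (suc (suc t)))

    skip-≤ : ∀ {t} → t ≤ k → skip t ≡ at W t
    skip-≤ = splice-≤ (at W) _

    skip-≥ : ∀ {t} → k ≤ t → skip t ≡ at W (suc (suc t))
    skip-≥ {t} k≤t with t ≤? k
    ... | no _ = refl
    ... | yes t≤k with refl ← ≤-antisym t≤k k≤t = backtrack

    <len : ∀ {t} → t ≤ suc (suc m) → t ≤ len W
    <len = subst (_ ≤_) (sym len≡)

    walk : Walk R P a b
    walk = record
      { at = skip ; len = m
      ; at-0 = trans (skip-≤ z≤n) (at-0 W)
      ; at-len = trans (skip-≥ k≤m) (trans (cong (at W) (sym len≡)) (at-len W))
      ; step = λ i i<m → stepAt i i<m (suc i ≤? k)
      ; within = λ i i≤m → withinAt i i≤m (i ≤? k) }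
      where
      stepAt : ∀ i → i < m → Dec (suc i ≤ k) → R (skip i) (skip (suc i))
      stepAt i i<m (yes si≤k) =
        subst₂ R (sym (skip-≤ (<⇒≤ si≤k))) (sym (skip-≤ si≤k)) (step W i (<len (m≤n⇒m≤1+n (m≤n⇒m≤1+n (≤-trans si≤k k≤m)))))
      stepAt i i<m (no si≰k) =
        subst₂ R (sym (skip-≥ k≤i)) (sym (skip-≥ (m≤n⇒m≤1+n k≤i))) (step W (suc (suc i)) (<len (s≤s (s≤s i<m))))
        where
        k≤i : k ≤ i
        k≤i = ≤-pred (≰⇒> si≰k)
      withinAt : ∀ i → i ≤ m → Dec (i ≤ k) → P (skip i)
      withinAt i i≤m (yes i≤k) = subst P (sym (skip-≤ i≤k)) (within W i (<len (m≤n⇒m≤1+n (m≤n⇒m≤1+n (≤-trans i≤k k≤m)))))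
      withinAt i i≤m (no i≰k) = subst P (sym (skip-≥ (<⇒≤ (≰⇒> i≰k)))) (within W (suc (suc i)) (<len (s≤s (s≤s i≤m))))

  removeBacktracks : DecidableEquality A → ∀ {a b} → Walk R P a b → Σ (Walk R P a b) NonBacktracking
  removeBacktracks _≟_ W = go (len W) W ≤-refl
    where
    go : ∀ {a b} n (W : Walk R P a b) → len W ≤ n → Σ (Walk R P a b) NonBacktracking
    shorten : ∀ {a b} n (W : Walk R P a b) → len W ≤ n → ∀ k l → len W ≡ l → k < l ∸ 1 →
              at W k ≡ at W (suc (suc k)) → Σ (Walk R P a b) NonBacktracking
    go n W len≤n with anyUpTo? (λ k → at W k ≟ at W (suc (suc k))) (len W ∸ 1)
    ... | no none = W , λ i si< backtrack → none (i , ∸-monoˡ-< si< (s≤s z≤n) , backtrack)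
    ... | yes (k , k< , backtrack) = shorten n W len≤n k (len W) refl k< backtrack
    shorten zero W len≤0 k (suc (suc m)) len≡ _ _ = contradiction (subst (_≤ 0) len≡ len≤0) λ ()
    shorten (suc n) W len≤n k (suc (suc m)) len≡ (s≤s k≤m) backtrack =
      go n (Shortcut.walk W k m len≡ k≤m backtrack) (<⇒≤ (≤-pred (≤-trans (≤-reflexive (sym len≡)) len≤n)))

module _ {A B : Set} {R : A → A → Set} {P : A → Set} {R′ : B → B → Set} {P′ : B → Set} (h : A → B)
         (hom : ∀ {x y} → P x → P y → R x y → R′ (h x) (h y)) (P⇒P′ : ∀ {x} → P x → P′ (h x)) where

  mapWalk : ∀ {a b} → Walk R P a b → Walk R′ P′ (h a) (h b)
  mapWalk W = record
    { at = λ t → h (at W t) ; len = len W ; at-0 = cong h (at-0 W) ; at-len = cong h (at-len W)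
    ; step = λ i i< → hom (within W i (<⇒≤ i<)) (within W (suc i) i<) (step W i i<)
    ; within = λ i i≤ → P⇒P′ (within W i i≤) }

  mapWalk-nonBacktracking : (∀ {x y} → P x → P y → h x ≡ h y → x ≡ y) →
                            ∀ {a b} (W : Walk R P a b) → NonBacktracking W → NonBacktracking (mapWalk W)
  mapWalk-nonBacktracking injectiveOn W nb i si< eq =
    nb i si< (injectiveOn (within W i (<⇒≤ (<⇒≤ si<))) (within W (suc (suc i)) si<) eq)

-- Cycles and periodic rays

module _ {A : Set} where

  segment : (ℕ → A) → ℕ → List A
  segment w zero = []
  segment w (suc k) = w 0 ∷ segment (λ i → w (suc i)) k

  length-segment : ∀ w k → length (segment w k) ≡ k
  length-segment w zero = refl
  length-segment w (suc k) = cong suc (length-segment (λ i → w (suc i)) k)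

  last-segment : ∀ w k → last (segment w (suc k)) ≡ just (w k)
  last-segment w zero = refl
  last-segment w (suc k) = last-segment (λ i → w (suc i)) k

  segment-linked : ∀ {R : A → A → Set} w k → (∀ i → suc i < k → R (w i) (w (suc i))) → Linked R (segment w k)
  segment-linked w zero _ = []
  segment-linked w (suc zero) _ = [-]
  segment-linked w (suc (suc k)) steps =
    steps 0 (s≤s (s≤s z≤n)) ∷ segment-linked (λ i → w (suc i)) (suc k) (λ i i< → steps (suc i) (s≤s i<))

  ∈-segment⁻ : ∀ w k {x} → x ∈ segment w k → Σ ℕ λ i → i < k × x ≡ w i
  ∈-segment⁻ w (suc k) (here x≡) = 0 , s≤s z≤n , x≡
  ∈-segment⁻ w (suc k) (there x∈) with i , i<k , x≡ ← ∈-segment⁻ (λ i → w (suc i)) k x∈ = suc i , s≤s i<k , x≡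

  segment-unique : ∀ w k → (∀ {i j} → i < j → j < k → w i ≢ w j) → Unique (segment w k)
  segment-unique w zero _ = []
  segment-unique w (suc k) distinct =
    All.tabulate (λ x∈ → let i , i<k , x≡ = ∈-segment⁻ (λ i → w (suc i)) k x∈ in
                          λ w0≡x → distinct (s≤s z≤n) (s≤s i<k) (trans w0≡x x≡)) ∷
    segment-unique (λ i → w (suc i)) k (λ i<j j<k → distinct (s≤s i<j) (s≤s j<k))

module _ (G : Graph) {P : Vtx G → Set} {a b} (W : Walk (Adj G) P a b) (nb : NonBacktracking W) where

  private
    Repeats : ℕ → Set
    Repeats m = Σ ℕ λ k → k < m × at W k ≡ at W m

    Repeats? : ∀ m → Dec (Repeats m)
    Repeats? m = anyUpTo? (λ k → at W k ≟ᶠ at W m) m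

  -- Cut the walk at its first repeated vertex.
  repeat⇒cycle : ∀ {i j} → i < j → j ≤ len W → at W i ≡ at W j → Σ (List (Vtx G)) (IsCycle G)
  repeat⇒cycle {i} {j} i<j j≤len repeat
    with m , m≤j , (k , k<m , at-k≡at-m) , first ← least-witness Repeats? {j} (i , i<j , repeat)
    with o , k+o≡m ← m≤n⇒∃[o]m+o≡n k<m = cycleFrom o k+o≡m
    where
    m≤len : m ≤ len W
    m≤len = ≤-trans m≤j j≤len
    u : ℕ → Vtx G
    u i = at W (k + i)

    cycleFrom : ∀ o → suc k + o ≡ m → Σ (List (Vtx G)) (IsCycle G)
    cycleFrom zero refl = contradiction (step W k (≤-trans (≤-reflexive (sym (+-identityʳ (suc k)))) m≤len))
                            (subst (λ z → ¬ Adj G (at W k) z) (trans at-k≡at-m (cong (at W) (+-identityʳ (suc k))))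
                              (Adj-irrefl G))
    cycleFrom (suc zero) refl = contradiction (trans at-k≡at-m (cong (at W) (+-comm (suc k) 1)))
                                  (nb k (≤-trans (≤-reflexive (cong suc (+-comm 1 k))) m≤len))
    cycleFrom (suc (suc o)) refl = segment u (suc (suc (suc o))) , 3≤ , unique , linked , closing
      where
      3≤ : 3 ≤ length (segment u (suc (suc (suc o))))
      3≤ = ≤-trans (s≤s (s≤s (s≤s z≤n))) (≤-reflexive (sym (length-segment u (suc (suc (suc o))))))
      inside : ∀ {t} → t < suc (suc (suc o)) → k + t < m
      inside {t} t< = subst (k + t <_) (+-suc k (suc (suc o))) (+-monoʳ-< k t<)
      unique : Unique (segment u (suc (suc (suc o))))
      unique = segment-unique u _ λ t<t' t'< eq →
        first (inside t'<) (k + _ , +-monoʳ-< k t<t' , eq)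
      linked : Linked (Adj G) (segment u (suc (suc (suc o))))
      linked = segment-linked u _ λ t st< →
        subst (λ z → Adj G (u t) (at W z)) (sym (+-suc k t)) (step W (k + t) (≤-trans (≤-trans (≤-reflexive (sym (+-suc k t))) (<⇒≤ (inside st<))) m≤len))
      closing : ∀ x y → head (segment u (suc (suc (suc o)))) ≡ just x →
                last (segment u (suc (suc (suc o)))) ≡ just y → Adj G y x
      closing x y refl last≡ =
        subst₂ (Adj G) (just-injective (trans (sym (last-segment u (suc (suc o)))) last≡))
          (trans (sym at-k≡at-m) (cong (at W) (sym (+-identityʳ k))))
          (step W (k + suc (suc o)) m≤len)

Acyclic⇒noClosedWalk : ∀ {G} → Acyclic G → ∀ {P : Vtx G → Set} {a b} (W : Walk (Adj G) P a b) →
                       NonBacktracking W → 0 < len W → a ≡ b → ⊥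
Acyclic⇒noClosedWalk {G} acyclic W nb 0<len refl =
  let cycle , isCycle = repeat⇒cycle G W nb 0<len ≤-refl (trans (at-0 W) (sym (at-len W))) in
  acyclic cycle isCycle

module _ {A : Set} (default : A) where

  nth : List A → ℕ → A
  nth [] _ = default
  nth (x ∷ xs) zero = x
  nth (x ∷ xs) (suc k) = nth xs k

  nth-linked : ∀ {R : A → A → Set} {xs k} → Linked R xs → suc k < length xs → R (nth xs k) (nth xs (suc k))
  nth-linked {k = zero} (r ∷ _) _ = r
  nth-linked {k = suc k} (_ ∷ rs) (s≤s k<) = nth-linked rs k<
  nth-linked [-] (s≤s ())

  nth-∈ : ∀ {xs k} → k < length xs → nth xs k ∈ xs
  nth-∈ {x ∷ xs} {zero} _ = here refl
  nth-∈ {x ∷ xs} {suc k} (s≤s k<) = there (nth-∈ k<)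

  nth-injective : ∀ {xs i j} → Unique xs → i < j → j < length xs → nth xs i ≢ nth xs j
  nth-injective {x ∷ xs} {zero} {suc j} (x∉ ∷ _) _ (s≤s j<) = All.lookup x∉ (nth-∈ j<)
  nth-injective {x ∷ xs} {suc i} {suc j} (_ ∷ uniq) (s≤s i<j) (s≤s j<) = nth-injective uniq i<j j<

  last-nth : ∀ x xs → last (x ∷ xs) ≡ just (nth (x ∷ xs) (length xs))
  last-nth x [] = refl
  last-nth x (y ∷ xs) = last-nth y xs

record PeriodicRay (G : Graph) : Set where
  field
    ray                 : ℕ → Vtx G
    period-1            : ℕ
    ray-step            : ∀ i → Adj G (ray i) (ray (suc i))
    ray-nonBacktracking : ∀ i → ray i ≢ ray (suc (suc i))
    periodic            : ∀ i → ray (i + suc period-1) ≡ ray i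

  period : ℕ
  period = suc period-1
open PeriodicRay public

cycle⇒periodicRay : ∀ {G} vs → IsCycle G vs → PeriodicRay G
cycle⇒periodicRay {G} (v ∷ vs₀) (3≤ , unique , linked , closing) = record
  { ray = around ; period-1 = length vs₀
  ; ray-step = λ i → subst₂ (Adj G) (sym (shift 0 i)) (sym (shift 1 i)) (step< (i % L) (m%n<n i L))
  ; ray-nonBacktracking = λ i → subst₂ _≢_ (sym (shift 0 i)) (sym (shift 2 i)) (nb< (i % L) (m%n<n i L))
  ; periodic = λ i → cong (nth v vs) ([m+n]%n≡m%n i L) }
  where
  vs : List (Vtx G)
  vs = v ∷ vs₀
  L : ℕ
  L = length vs
  around : ℕ → Vtx G
  around i = nth v vs (i % L)

  shift : ∀ j i → around (j + i) ≡ around (j + i % L)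
  shift j i = cong (nth v vs) (begin
    (j + i) % L                       ≡⟨ cong (λ z → (j + z) % L) (m≡m%n+[m/n]*n i L) ⟩
    (j + (i % L + (i / L) * L)) % L   ≡⟨ cong (_% L) (sym (+-assoc j (i % L) _)) ⟩
    (j + i % L + (i / L) * L) % L     ≡⟨ [m+kn]%n≡m%n (j + i % L) (i / L) L ⟩
    (j + i % L) % L                   ∎)
    where open ≡-Reasoning

  around-< : ∀ {r} → r < L → around r ≡ nth v vs r
  around-< r<L = cong (nth v vs) (m<n⇒m%n≡m r<L)

  around-L : around L ≡ v
  around-L = cong (nth v vs) (n%n≡0 L)

  step< : ∀ r → r < L → Adj G (around r) (around (suc r))
  step< r r<L with <-cmp (suc r) L
  ... | tri< sr<L _ _ = subst₂ (Adj G) (sym (around-< r<L)) (sym (around-< sr<L)) (nth-linked v linked sr<L)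
  ... | tri> _ _ sr>L = contradiction r<L (≤⇒≯ (≤-pred sr>L))
  ... | tri≈ _ refl _ = subst₂ (Adj G) (sym (around-< r<L)) (sym around-L) (closing v _ refl (last-nth v v vs₀))

  nb< : ∀ r → r < L → around r ≢ around (suc (suc r))
  nb< r r<L with <-cmp (suc (suc r)) L
  ... | tri< ssr<L _ _ = subst₂ _≢_ (sym (around-< r<L)) (sym (around-< ssr<L))
                           (nth-injective v unique (<-trans (n<1+n r) (n<1+n (suc r))) ssr<L)
  ... | tri≈ _ ssr≡L _ = subst₂ _≢_ (sym (around-< r<L)) (sym (trans (cong around ssr≡L) around-L))
                           (λ eq → nth-injective v unique (≤-pred (≤-pred (≤-trans 3≤ (≤-reflexive (sym ssr≡L))))) r<L (sym eq))
  ... | tri> _ _ ssr>L with refl ← ≤-antisym (≤-pred r<L) (≤-pred (≤-pred ssr>L)) =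
    subst₂ _≢_ (sym (around-< r<L)) (sym (trans (shift 1 L) (cong (λ z → around (1 + z)) (n%n≡0 L))))
      (λ eq → nth-injective v unique (≤-pred 3≤) r<L (sym (trans eq (around-< (≤-trans (s≤s (s≤s z≤n)) 3≤)))))

module _ {G : Graph} (R : PeriodicRay G) where

  ray-+* : ∀ i m → ray R (i + m * period R) ≡ ray R i
  ray-+* i zero = cong (ray R) (+-identityʳ i)
  ray-+* i (suc m) = begin
    ray R (i + (period R + m * period R))  ≡⟨ cong (λ z → ray R (i + z)) (+-comm (period R) (m * period R)) ⟩
    ray R (i + (m * period R + period R))  ≡⟨ cong (ray R) (sym (+-assoc i (m * period R) (period R))) ⟩
    ray R (i + m * period R + period R)    ≡⟨ periodic R (i + m * period R) ⟩
    ray R (i + m * period R)               ≡⟨ ray-+* i m ⟩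
    ray R i                                ∎
    where open ≡-Reasoning

  ray-all : (Q : Vtx G → Set) → (∀ k → k < period R → Q (ray R k)) → ∀ i → Q (ray R i)
  ray-all Q below i =
    subst Q (trans (sym (ray-+* (i % period R) (i / period R))) (cong (ray R) (sym (m≡m%n+[m/n]*n i (period R)))))
      (below (i % period R) (m%n<n i (period R)))

  ray-two-neighbours : ∀ i {c} → ¬ (∀ {k} → Adj G (ray R i) (ray R k) → ray R k ≡ c)
  ray-two-neighbours i only-c = ray-nonBacktracking R (i + period-1 R) (trans (only-c pred-adj) (trans (sym (only-c (ray-step R i))) (sym (wraps (suc i)))))
    where
    wraps : ∀ j → ray R (suc (j + period-1 R)) ≡ ray R j
    wraps j = trans (cong (ray R) (sym (+-suc j (period-1 R)))) (periodic R j)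
    pred-adj : Adj G (ray R i) (ray R (i + period-1 R))
    pred-adj = Adj-sym G (subst (Adj G (ray R (i + period-1 R))) (wraps i) (ray-step R (i + period-1 R)))

  ray-first-after : {Q : Vtx G → Set} → (∀ v → Dec (Q v)) → ∀ a {m} → Q (ray R m) →
                    Σ ℕ λ j → a < j × Q (ray R j) × (∀ {k} → a < k → k < j → ¬ Q (ray R k))
  ray-first-after {Q} Q? a {m} Qm = first-after (λ n → Q? (ray R n)) a
    (≤-trans (m≤m*n (suc a) (period R)) (m≤n+m _ m)) (subst Q (sym (ray-+* m (suc a))) Qm)

  ray-arc : {Q : Vtx G → Set} → (∀ v → Dec (Q v)) → ∀ {x g} → Q (ray R x) → ¬ Q (ray R g) →
            Σ ℕ λ i → Σ ℕ λ d → 2 ≤ d × ¬ Q (ray R i) × ¬ Q (ray R (i + d)) ×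
              (∀ {k} → 0 < k → k < d → Q (ray R (i + k)))
  ray-arc {Q} Q? {x} {g} Qx ¬Qg
    with suc i , g<j₁ , Qj₁ , ¬Q-before ← ray-first-after Q? g Qx
    with j₂ , j₁<j₂ , ¬Qj₂ , Q-before ← ray-first-after (λ v → ¬? (Q? v)) (suc i) ¬Qg
    with o , refl ← m≤n⇒∃[o]m+o≡n j₁<j₂ =
    i , suc (suc o) , s≤s (s≤s z≤n) , ¬Qi , subst (λ z → ¬ Q (ray R z)) (sym i+d) ¬Qj₂ , interior
    where
    i+d : i + suc (suc o) ≡ suc (suc (i + o))
    i+d = trans (+-suc i (suc o)) (cong suc (+-suc i o))
    ¬Qi : ¬ Q (ray R i)
    ¬Qi with g ≟ i
    ... | yes refl = ¬Qg
    ... | no g≢i = ¬Q-before (≤∧≢⇒< (≤-pred g<j₁) g≢i) ≤-refl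
    interior : ∀ {k} → 0 < k → k < suc (suc o) → Q (ray R (i + k))
    interior {suc zero} _ _ = subst (λ z → Q (ray R z)) (sym (+-comm i 1)) Qj₁
    interior {suc (suc k)} _ k< = decidable-stable (Q? _)
      (subst (λ z → ¬ ¬ Q (ray R z)) (sym (+-suc i (suc k)))
        (Q-before (s≤s (m<m+n i (s≤s z≤n))) (s≤s (s≤s (+-monoʳ-≤ i (≤-pred (≤-pred k<)))))))

  raySegment : ∀ {P : Vtx G → Set} i d → (∀ k → k ≤ d → P (ray R (i + k))) → Walk (Adj G) P (ray R i) (ray R (i + d))
  raySegment i d inside = record
    { at = λ k → ray R (i + k) ; len = d ; at-0 = cong (ray R) (+-identityʳ i) ; at-len = refl
    ; step = λ k _ → subst (λ z → Adj G (ray R (i + k)) (ray R z)) (sym (+-suc i k)) (ray-step R (i + k))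
    ; within = inside }

  raySegment-nonBacktracking : ∀ {P : Vtx G → Set} i d (inside : ∀ k → k ≤ d → P (ray R (i + k))) →
                               NonBacktracking (raySegment {P = P} i d inside)
  raySegment-nonBacktracking i d _ k _ =
    subst (λ z → ray R (i + k) ≢ ray R z) (sym (trans (+-suc i (suc k)) (cong suc (+-suc i k))))
      (ray-nonBacktracking R (i + k))

ray-reflect : ∀ {G H} → Acyclic H → (R : PeriodicRay G) {P : Vtx G → Set} → (∀ i → P (ray R i)) →
              (h : Vtx G → Vtx H) → (∀ {u v} → P u → P v → Adj G u v → Adj H (h u) (h v)) →
              (∀ {u v} → P u → P v → h u ≡ h v → u ≡ v) → ⊥
ray-reflect {G} {H} acyclic R {P} on-ray h hom injectiveOn =
  Acyclic⇒noClosedWalk {H} acyclic (mapWalk {R′ = Adj H} {P′ = λ _ → ⊤} h hom (λ _ → tt) lap)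
    (mapWalk-nonBacktracking {R′ = Adj H} {P′ = λ _ → ⊤} h hom (λ _ → tt) injectiveOn lap lap-nb)
    (s≤s z≤n) (cong h (sym (periodic R 0)))
  where
  inside : ∀ k → k ≤ period R → P (ray R k)
  inside k _ = on-ray k
  lap : Walk (Adj G) P (ray R 0) (ray R (0 + period R))
  lap = raySegment R 0 (period R) inside
  lap-nb : NonBacktracking lap
  lap-nb = raySegment-nonBacktracking R {P} 0 (period R) inside

PeriodicRay-free⇒Acyclic : ∀ {G} → (PeriodicRay G → ⊥) → Acyclic G
PeriodicRay-free⇒Acyclic no-ray vs isCycle = no-ray (cycle⇒periodicRay vs isCycle)

does⇒ : {A : Set} (a? : Dec A) → does a? ≡ true → A
does⇒ (yes a) _ = a

module CodedGraph {V : Set} {N : ℕ} (code : V ↔ Fin N) {Link : V → V → Set}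
                  (link? : ∀ u v → Dec (Link u v)) (link-sym : ∀ {u v} → Link u v → Link v u)
                  (link-irrefl : ∀ {u} → ¬ Link u u) where

  open Inverse code public using (to; from; strictlyInverseˡ; strictlyInverseʳ)

  graph : Graph
  graph = record
    { size = N
    ; adj = λ i j → does (link? (from i) (from j))
    ; irrefl = λ i → dec-false (link? (from i) (from i)) link-irrefl
    ; sym = λ i j → does-≡ (link? (from i) (from j)) (map′ link-sym link-sym (link? (from j) (from i))) }

  Adj⇒Link : ∀ {i j} → Adj graph i j → Link (from i) (from j)
  Adj⇒Link {i} {j} = does⇒ (link? (from i) (from j))

  Link⇒Adj : ∀ {u v} → Link u v → Adj graph (to u) (to v)
  Link⇒Adj {u} {v} l = dec-true (link? _ _) (subst₂ Link (sym (strictlyInverseʳ u)) (sym (strictlyInverseʳ v)) l)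

  Adj-to⇒Link : ∀ {u v} → Adj graph (to u) (to v) → Link u v
  Adj-to⇒Link a = subst₂ Link (strictlyInverseʳ _) (strictlyInverseʳ _) (Adj⇒Link a)

  from-injective : ∀ {i j} → from i ≡ from j → i ≡ j
  from-injective {i} {j} eq = trans (sym (strictlyInverseˡ i)) (trans (cong to eq) (strictlyInverseˡ j))

  Adj-toˡ⇒Link : ∀ {u i} → Adj graph (to u) i → Link u (from i)
  Adj-toˡ⇒Link {u} {i} a = subst (λ z → Link z (from i)) (strictlyInverseʳ u) (Adj⇒Link a)

  adj-to : ∀ {u v b} → (Link u v → b ≡ true) → (b ≡ true → Link u v) → adj graph (to u) (to v) ≡ b
  adj-to {u} {v} {true} _ from-b = Link⇒Adj (from-b refl)
  adj-to {u} {v} {false} to-b _ =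
    dec-false (link? _ _) λ l → contradiction (to-b (subst₂ Link (strictlyInverseʳ u) (strictlyInverseʳ v) l)) λ ()

  to-injective : ∀ {u v} → to u ≡ to v → u ≡ v
  to-injective {u} {v} eq = trans (sym (strictlyInverseʳ u)) (trans (cong from eq) (strictlyInverseʳ v))

  degree-to-≤ : ∀ {u} (vs : List V) → (∀ {v} → Link u v → v ∈ vs) → degree graph (to u) ≤ length vs
  degree-to-≤ {u} vs into = subst (degree graph (to u) ≤_) (length-map to vs)
    (degree-≤-length graph (map to vs) λ {i} a →
      subst (_∈ map to vs) (strictlyInverseˡ i) (∈-map⁺ to (into (Adj-to⇒Link (subst (Adj graph (to u)) (sym (strictlyInverseˡ i)) a)))))

  3≤degree-to : ∀ {u a b c} → Link u a → Link u b → Link u c → a ≢ b → a ≢ c → b ≢ c → 3 ≤ degree graph (to u)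
  3≤degree-to ua ub uc a≢b a≢c b≢c =
    3≤degree graph (Link⇒Adj ua) (Link⇒Adj ub) (Link⇒Adj uc)
      (λ eq → a≢b (to-injective eq)) (λ eq → a≢c (to-injective eq)) (λ eq → b≢c (to-injective eq))

  degree-from : ∀ i → degree graph (to (from i)) ≡ degree graph i
  degree-from i = cong (degree graph) (strictlyInverseˡ i)

-- Acyclicity of a graph covered by two parts

module Gluing (G : Graph) {A B : Vtx G → Set} (A? : ∀ v → Dec (A v)) (B? : ∀ v → Dec (B v))
              (edge-side : ∀ {u v} → Adj G u v → (A u × A v) ⊎ (B u × B v)) where

  record Bridge (R : PeriodicRay G) : Set where
    field
      start span : ℕ
      long       : 2 ≤ span
      start-A    : A (ray R start)
      start-B    : B (ray R start)
      end-A      : A (ray R (start + span))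
      end-B      : B (ray R (start + span))
      interior   : ∀ {k} → 0 < k → k < span → A (ray R (start + k)) × ¬ B (ray R (start + k))

  private
    A-beside-¬B : ∀ {u v} → Adj G u v → ¬ B v → A u
    A-beside-¬B a ¬Bv with edge-side a
    ... | inj₁ (Au , _) = Au
    ... | inj₂ (_ , Bv) = contradiction Bv ¬Bv

    OnlyA : Vtx G → Set
    OnlyA v = A v × ¬ B v

    B-unless-OnlyA : ∀ {u} → A u → ¬ OnlyA u → B u
    B-unless-OnlyA Au ¬only = decidable-stable (B? _) λ ¬Bu → ¬only (Au , ¬Bu)

    OnlyA? : ∀ v → Dec (OnlyA v)
    OnlyA? v = A? v ×-dec ¬? (B? v)

    arc⇒bridge : ∀ (R : PeriodicRay G) i d → 2 ≤ d → ¬ OnlyA (ray R i) → ¬ OnlyA (ray R (i + d)) →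
                 (∀ {k} → 0 < k → k < d → OnlyA (ray R (i + k))) → Bridge R
    arc⇒bridge R i (suc d) 2≤d ¬only-i ¬only-end interior = record
      { start = i ; span = suc d ; long = 2≤d
      ; start-A = start-A ; start-B = B-unless-OnlyA start-A ¬only-i
      ; end-A = end-A ; end-B = B-unless-OnlyA end-A ¬only-end ; interior = interior }
      where
      start-A : A (ray R i)
      start-A = A-beside-¬B {ray R i} {ray R (i + 1)} (subst (λ z → Adj G (ray R i) (ray R z)) (+-comm 1 i) (ray-step R i))
                  (proj₂ (interior (s≤s z≤n) 2≤d))
      end-A : A (ray R (i + suc d))
      end-A = A-beside-¬B {ray R (i + suc d)} {ray R (i + d)} (Adj-sym G (subst (λ z → Adj G (ray R (i + d)) (ray R z)) (sym (+-suc i d)) (ray-step R (i + d))))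
                (proj₂ (interior (≤-pred 2≤d) ≤-refl))

    all-B : ∀ (R : PeriodicRay G) → (∀ k → k < period R → ¬ OnlyA (ray R k)) → ∀ i → B (ray R i)
    all-B R none = ray-all R B below
      where
      below : ∀ k → k < period R → B (ray R k)
      below k k< with edge-side {ray R k} {ray R (suc k)} (ray-step R k)
      ... | inj₁ (Au , _) = B-unless-OnlyA Au (none k k<)
      ... | inj₂ (Bu , _) = Bu

    all-A : ∀ (R : PeriodicRay G) → (∀ k → k < period R → ¬ ¬ OnlyA (ray R k)) → ∀ i → A (ray R i)
    all-A R all = ray-all R A λ k k< → proj₁ (decidable-stable (OnlyA? _) (all k k<))

  -- A cycle meeting both A ∖ B and its complement leaves A ∖ B on both ends into A ∩ B.
  glued-acyclic : (∀ (R : PeriodicRay G) → (∀ i → A (ray R i)) → ⊥) → (∀ (R : PeriodicRay G) → (∀ i → B (ray R i)) → ⊥) →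
                  (∀ R → Bridge R → ⊥) →
                  Acyclic G
  glued-acyclic no-ray-in-A no-ray-in-B no-bridge = PeriodicRay-free⇒Acyclic λ R →
    case R (anyUpTo? (λ k → OnlyA? (ray R k)) (period R)) (anyUpTo? (λ k → ¬? (OnlyA? (ray R k))) (period R))
    where
    case : ∀ (R : PeriodicRay G) → Dec (Σ ℕ λ k → k < period R × OnlyA (ray R k)) → Dec (Σ ℕ λ k → k < period R × ¬ OnlyA (ray R k)) → ⊥
    case R (no none) _ = no-ray-in-B R (all-B R λ k k< only → none (k , k< , only))
    case R (yes _) (no none) = no-ray-in-A R (all-A R λ k k< ¬only → none (k , k< , ¬only))
    case R (yes (x , _ , only-x)) (yes (g , _ , ¬only-g)) =
      let i , d , 2≤d , ¬only-i , ¬only-end , interior = ray-arc R OnlyA? only-x ¬only-g in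
      no-bridge R (arc⇒bridge R i d 2≤d ¬only-i ¬only-end interior)

module _ (G : Graph) where

  Independent : (Vtx G → Set) → Set
  Independent I = ∀ {u v} → I u → I v → ¬ Adj G u v

  Dominated : (Vtx G → Set) → Vtx G → Set
  Dominated I v = I v ⊎ Σ (Vtx G) λ u → Adj G v u × I u

  record MaximalIndependentExtension (I₀ : Vtx G → Set) : Set₁ where
    field
      member      : Vtx G → Set
      member?     : ∀ v → Dec (member v)
      extends     : ∀ {v} → I₀ v → member v
      independent : Independent member
      dominating  : ∀ {v} → ¬ member v → Σ (Vtx G) λ u → Adj G v u × member u

  private
    record PartialExtension (I₀ : Vtx G → Set) (vs : List (Vtx G)) : Set₁ where
      field
        member      : Vtx G → Set
        member?     : ∀ v → Dec (member v)
        extends     : ∀ {v} → I₀ v → member v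
        independent : Independent member
        dominates   : ∀ {v} → v ∈ vs → Dominated member v

    extend : ∀ {I : Vtx G → Set} → (∀ v → Dec (I v)) → Independent I → ∀ vs → PartialExtension I vs
    extend {I} I? indep [] = record
      { member = I ; member? = I? ; extends = λ p → p ; independent = indep ; dominates = λ () }
    extend {I} I? indep (v ∷ vs) with I? v ⊎-dec any? (λ u → Adj? G v u ×-dec I? u)
    ... | yes dominated = record
      { member = member ; member? = member? ; extends = extends ; independent = independent
      ; dominates = λ { (here refl) → grow dominated ; (there w∈) → dominates w∈ } }
      where
      open PartialExtension (extend I? indep vs)
      grow : Dominated I v → Dominated member v
      grow (inj₁ Iv) = inj₁ (extends Iv)
      grow (inj₂ (u , vu , Iu)) = inj₂ (u , vu , extends Iu)
    ... | no undominated = record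
      { member = member ; member? = member? ; extends = λ Iw → extends (inj₁ Iw) ; independent = independent
      ; dominates = λ { (here refl) → inj₁ (extends (inj₂ refl)) ; (there w∈) → dominates w∈ } }
      where
      I+v : Vtx G → Set
      I+v u = I u ⊎ u ≡ v
      indep+v : Independent I+v
      indep+v (inj₁ Iu) (inj₁ Iw) = indep Iu Iw
      indep+v (inj₁ Iu) (inj₂ refl) uv = undominated (inj₂ (_ , Adj-sym G uv , Iu))
      indep+v (inj₂ refl) (inj₁ Iw) uw = undominated (inj₂ (_ , uw , Iw))
      indep+v (inj₂ refl) (inj₂ refl) = Adj-irrefl G
      open PartialExtension (extend (λ u → I? u ⊎-dec (u ≟ᶠ v)) indep+v vs)

  maximalIndependentExtension : ∀ {I₀} → (∀ v → Dec (I₀ v)) → Independent I₀ → MaximalIndependentExtension I₀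
  maximalIndependentExtension I₀? indep = record
    { member = member ; member? = member? ; extends = extends ; independent = independent
    ; dominating = λ {v} ¬member → dominated (dominates (∈-allFin v)) ¬member }
    where
    open PartialExtension (extend I₀? indep (allFin (size G)))
    dominated : ∀ {v} → Dominated member v → ¬ member v → Σ (Vtx G) λ u → Adj G v u × member u
    dominated (inj₁ m) ¬m = contradiction m ¬m
    dominated (inj₂ d) _ = d

module _ (G : Graph) where

  Reach : ℕ → Vtx G → Vtx G → Set
  Reach zero u v = u ≡ v
  Reach (suc k) u v = Reach k u v ⊎ Σ (Vtx G) λ w → Reach k u w × Adj G w v

  Reach? : ∀ k u v → Dec (Reach k u v)
  Reach? zero u v = u ≟ᶠ v
  Reach? (suc k) u v = Reach? k u v ⊎-dec any? (λ w → Reach? k u w ×-dec Adj? G w v)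

  Reach-mono : ∀ {k k' u v} → k ≤ k' → Reach k u v → Reach k' u v
  Reach-mono {k} {k'} {u} {v} k≤k' r with o , refl ← m≤n⇒∃[o]m+o≡n k≤k' = go o
    where
    go : ∀ o → Reach (k + o) u v
    go zero = subst (λ z → Reach z u v) (sym (+-identityʳ k)) r
    go (suc o) = subst (λ z → Reach z u v) (sym (+-suc k o)) (inj₁ (go o))

  Walk⇒Reach : ∀ {P : Vtx G → Set} {u v} (W : Walk (Adj G) P u v) → Reach (len W) u v
  Walk⇒Reach {u = u} W = subst (Reach (len W) u) (at-len W) (prefix (len W) ≤-refl)
    where
    prefix : ∀ t → t ≤ len W → Reach t u (at W t)
    prefix zero _ = sym (at-0 W)
    prefix (suc t) t< = inj₂ (at W t , prefix t (<⇒≤ t<) , step W t t<)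

  Reach⇒Walk : ∀ {k u v} → Reach k u v → Walk (Adj G) (λ _ → ⊤) u v
  Reach⇒Walk {zero} refl = stay tt
  Reach⇒Walk {suc k} (inj₁ r) = Reach⇒Walk r
  Reach⇒Walk {suc k} (inj₂ (w , r , a)) = Reach⇒Walk r ++ʷ hop tt tt a

  nonBacktracking-len<size : Acyclic G → ∀ {P : Vtx G → Set} {u v} (W : Walk (Adj G) P u v) → NonBacktracking W →
                             len W < size G
  nonBacktracking-len<size acyclic W nb with len W <? size G
  ... | yes len< = len<
  ... | no len≮ with i , j , i<j , same ← pigeonhole (n<1+n (size G)) (λ i → at W (toℕ i)) =
    contradiction (repeat⇒cycle G W nb i<j (≤-trans (≤-pred (toℕ<n j)) (≮⇒≥ len≮)) same) λ (vs , isCycle) → acyclic vs isCycle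

-- In an acyclic graph, the least B-vertex of each component (by index) represents it.
module Representatives (G : Graph) (acyclic : Acyclic G) {B : Vtx G → Set} (B? : ∀ v → Dec (B v)) where

  EarlierReachable : Vtx G → Set
  EarlierReachable r = Σ (Vtx G) λ u → toℕ u < toℕ r × B u × Reach G (size G) r u

  IsRoot : Vtx G → Set
  IsRoot r = B r × ¬ EarlierReachable r

  EarlierReachable? : ∀ r → Dec (EarlierReachable r)
  EarlierReachable? r = any? λ u → (toℕ u <? toℕ r) ×-dec (B? u ×-dec Reach? G (size G) r u)

  IsRoot? : ∀ r → Dec (IsRoot r)
  IsRoot? r = B? r ×-dec ¬? (EarlierReachable? r)

  walk-to-root : ∀ {b} → B b → Σ (Vtx G) λ r → IsRoot r × Walk (Adj G) (λ _ → ⊤) b r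
  walk-to-root {b} Bb = go (suc (toℕ b)) ≤-refl Bb
    where
    go : ∀ fuel {b} → toℕ b < fuel → B b → Σ (Vtx G) λ r → IsRoot r × Walk (Adj G) (λ _ → ⊤) b r
    go (suc fuel) {b} b< Bb with IsRoot? b
    ... | yes root = b , root , stay tt
    ... | no ¬root with u , u<b , Bu , reach ← decidable-stable (EarlierReachable? b) (λ none → ¬root (Bb , none))
      with r , root , W ← go fuel (≤-trans u<b (≤-pred b<)) Bu = r , root , Reach⇒Walk G reach ++ʷ W

  private
    within-size : ∀ {P : Vtx G → Set} {u v} (W : Walk (Adj G) P u v) → NonBacktracking W →
                  ∀ {x y} → Reach G (len W) x y → Reach G (size G) x y
    within-size W nb = Reach-mono G (<⇒≤ (nonBacktracking-len<size G acyclic W nb))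

  roots-equal : ∀ {P : Vtx G → Set} {r₁ r₂} → IsRoot r₁ → IsRoot r₂ → (W : Walk (Adj G) P r₁ r₂) → NonBacktracking W →
                r₁ ≡ r₂
  roots-equal {r₁ = r₁} {r₂} (Br₁ , first₁) (Br₂ , first₂) W nb with <-cmp (toℕ r₁) (toℕ r₂)
  ... | tri≈ _ eq _ = toℕ-injective eq
  ... | tri< r₁<r₂ _ _ = contradiction (r₁ , r₁<r₂ , Br₁ , within-size W nb (Walk⇒Reach G (reverse (Adj-sym G) W))) first₂
  ... | tri> _ _ r₁>r₂ = contradiction (r₂ , r₁>r₂ , Br₂ , within-size W nb (Walk⇒Reach G W)) first₁

-- Amalgamation along a connected saturated set

record Saturated (Q : Graph) (S : Vtx Q → Set) (s : Vtx Q) : Set where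
  field
    glued₁ glued₂ branch : Vtx Q
    adj₁               : Adj Q s glued₁
    adj₂               : Adj Q s glued₂
    distinct           : glued₁ ≢ glued₂
    S₁                 : S glued₁
    S₂                 : S glued₂
    adj-branch         : Adj Q s branch
    branching          : 3 ≤ degree Q branch

module _ {Q H : Graph} {S : Vtx Q → Set} (nab : NoAdjacentBranching H) (e : Embedding Q H)
         {s : Vtx Q} (sat : Saturated Q S s) where
  open Saturated sat

  saturated-degree≤2 : degree H (embed e s) ≤ 2
  saturated-degree≤2 with degree H (embed e s) ≤? 2
  ... | yes ≤2 = ≤2
  ... | no ≰2 = contradiction (≤-trans branching (degree-≤-embed e branch))
                  (nab (embed e s) (embed e branch) (Adj-embed e {s} {branch} adj-branch) (≰⇒> ≰2))

  saturated-neighbour : ∀ {x} → Adj H (embed e s) x → x ≡ embed e glued₁ ⊎ x ≡ embed e glued₂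
  saturated-neighbour =
    degree≤2⇒neighbour H saturated-degree≤2 (Adj-embed e {s} {glued₁} adj₁) (Adj-embed e {s} {glued₂} adj₂)
      (λ eq → distinct (injective e eq))

module Amalgamation {Q X Y : Graph} (f : Embedding Q X) (g : Embedding Q Y)
                    {S : Vtx Q → Set} (S? : ∀ s → Dec (S s)) where

  GluedX : Vtx X → Set
  GluedX x = Σ (Vtx Q) λ s → S s × embed f s ≡ x

  GluedY : Vtx Y → Set
  GluedY y = Σ (Vtx Q) λ s → S s × embed g s ≡ y

  GluedX? : ∀ x → Dec (GluedX x)
  GluedX? x = any? λ s → S? s ×-dec (embed f s ≟ᶠ x)

  GluedY? : ∀ y → Dec (GluedY y)
  GluedY? y = any? λ s → S? s ×-dec (embed g s ≟ᶠ y)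

  Live : Vtx Y → Set
  Live y = ¬ GluedY y

  -- The amalgam has all of X and the vertices of Y outside g(S); a vertex y ∉ g(S) is joined to
  -- f(s) exactly when g(s) ~ y.  The copies of g(S) in Y are kept as isolated dummy vertices.
  Vertex : Set
  Vertex = Vtx X ⊎ Vtx Y

  Cross : Vtx X → Vtx Y → Set
  Cross x y = Σ (Vtx Q) λ s → S s × embed f s ≡ x × Live y × Adj Y (embed g s) y

  Link : Vertex → Vertex → Set
  Link (inj₁ x) (inj₁ x') = Adj X x x'
  Link (inj₁ x) (inj₂ y) = Cross x y
  Link (inj₂ y) (inj₁ x) = Cross x y
  Link (inj₂ y) (inj₂ y') = Live y × Live y' × Adj Y y y'

  link? : ∀ p q → Dec (Link p q)
  link? (inj₁ x) (inj₁ x') = Adj? X x x'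
  link? (inj₁ x) (inj₂ y) = any? λ s → S? s ×-dec ((embed f s ≟ᶠ x) ×-dec (¬? (GluedY? y) ×-dec Adj? Y (embed g s) y))
  link? (inj₂ y) (inj₁ x) = link? (inj₁ x) (inj₂ y)
  link? (inj₂ y) (inj₂ y') = ¬? (GluedY? y) ×-dec (¬? (GluedY? y') ×-dec Adj? Y y y')

  link-sym : ∀ {p q} → Link p q → Link q p
  link-sym {inj₁ x} {inj₁ x'} = Adj-sym X {x} {x'}
  link-sym {inj₁ x} {inj₂ y} c = c
  link-sym {inj₂ y} {inj₁ x} c = c
  link-sym {inj₂ y} {inj₂ y'} (ly , ly' , a) = ly' , ly , Adj-sym Y {y} {y'} a

  link-irrefl : ∀ {p} → ¬ Link p p
  link-irrefl {inj₁ x} = Adj-irrefl X {x}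
  link-irrefl {inj₂ y} (_ , _ , a) = Adj-irrefl Y {y} a

  open CodedGraph (↔-sym +↔⊎) link? link-sym link-irrefl

  W : Graph
  W = graph

  f′ : Embedding X W
  f′ = record
    { map = λ x → to (inj₁ x)
    ; injective = λ eq → inj₁-injective (to-injective eq)
    ; preserves = λ x x' → adj-to (λ l → l) (λ a → a) }

  lift : Vtx Y → Vertex
  lift y with GluedY? y
  ... | yes (s , _) = inj₁ (embed f s)
  ... | no _ = inj₂ y

  data LiftView (y : Vtx Y) : Vertex → Set where
    glued : ∀ s → S s → embed g s ≡ y → LiftView y (inj₁ (embed f s))
    live  : Live y → LiftView y (inj₂ y)

  lift-view : ∀ y → LiftView y (lift y)
  lift-view y with GluedY? y
  ... | yes (s , Ss , gs≡y) = glued s Ss gs≡y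
  ... | no ¬glued = live ¬glued

  lift-glued : ∀ {s} → S s → lift (embed g s) ≡ inj₁ (embed f s)
  lift-glued {s} Ss with lift (embed g s) | lift-view (embed g s)
  ... | _ | glued s' _ gs'≡gs = cong (λ t → inj₁ (embed f t)) (injective g gs'≡gs)
  ... | _ | live ¬glued = contradiction (s , Ss , refl) ¬glued

  Link-lift⁻ : ∀ y y' → Link (lift y) (lift y') → Adj Y y y'
  Link-lift⁻ y y' with lift y | lift-view y | lift y' | lift-view y'
  ... | _ | glued s _ refl | _ | glued s' _ refl = λ l → Adj-embed g {s} {s'} (Adj-embed⁻ f {s} {s'} l)
  ... | _ | glued s _ refl | _ | live _ = λ { (t , _ , ft≡fs , _ , a) → subst (λ z → Adj Y (embed g z) y') (injective f ft≡fs) a }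
  ... | _ | live _ | _ | glued s' _ refl = λ { (t , _ , ft≡fs' , _ , a) →
                                               Adj-sym Y {embed g s'} {y} (subst (λ z → Adj Y (embed g z) y) (injective f ft≡fs') a) }
  ... | _ | live _ | _ | live _ = λ l → proj₂ (proj₂ l)

  Link-lift⁺ : ∀ y y' → Adj Y y y' → Link (lift y) (lift y')
  Link-lift⁺ y y' with lift y | lift-view y | lift y' | lift-view y'
  ... | _ | glued s _ refl | _ | glued s' _ refl = λ a → Adj-embed f {s} {s'} (Adj-embed⁻ g {s} {s'} a)
  ... | _ | glued s Ss refl | _ | live ly' = λ a → s , Ss , refl , ly' , a
  ... | _ | live ly | _ | glued s' Ss' refl = λ a → s' , Ss' , refl , ly , Adj-sym Y {y} {embed g s'} a
  ... | _ | live ly | _ | live ly' = λ a → ly , ly' , a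

  lift-injective : ∀ {y y'} → lift y ≡ lift y' → y ≡ y'
  lift-injective {y} {y'} with lift y | lift-view y | lift y' | lift-view y'
  ... | _ | glued s _ refl | _ | glued s' _ refl = λ eq → cong (embed g) (injective f (inj₁-injective eq))
  ... | _ | glued _ _ _ | _ | live _ = λ ()
  ... | _ | live _ | _ | glued _ _ _ = λ ()
  ... | _ | live _ | _ | live _ = inj₂-injective

  g′ : Embedding Y W
  g′ = record
    { map = λ y → to (lift y)
    ; injective = λ eq → lift-injective (to-injective eq)
    ; preserves = λ y y' → adj-to (Link-lift⁻ y y') (Link-lift⁺ y y') }

  f′-g′-agree : ∀ {s} → S s → embed f′ (embed f s) ≡ embed g′ (embed g s)
  f′-g′-agree Ss = cong to (sym (lift-glued Ss))

  XSide : Vertex → Set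
  XSide (inj₁ _) = ⊤
  XSide (inj₂ _) = ⊥

  YSide : Vertex → Set
  YSide (inj₁ x) = GluedX x
  YSide (inj₂ y) = Live y

  XSide? : ∀ p → Dec (XSide p)
  XSide? (inj₁ _) = yes tt
  XSide? (inj₂ _) = no λ ()

  YSide? : ∀ p → Dec (YSide p)
  YSide? (inj₁ x) = GluedX? x
  YSide? (inj₂ y) = ¬? (GluedY? y)

  Link-side : ∀ {p q} → Link p q → (XSide p × XSide q) ⊎ (YSide p × YSide q)
  Link-side {inj₁ x} {inj₁ x'} _ = inj₁ (tt , tt)
  Link-side {inj₁ x} {inj₂ y} (s , Ss , fs≡x , ly , _) = inj₂ ((s , Ss , fs≡x) , ly)
  Link-side {inj₂ y} {inj₁ x} (s , Ss , fs≡x , ly , _) = inj₂ (ly , (s , Ss , fs≡x))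
  Link-side {inj₂ y} {inj₂ y'} (ly , ly' , _) = inj₂ (ly , ly')

  projX : Vtx X → Vertex → Vtx X
  projX _ (inj₁ x) = x
  projX d (inj₂ _) = d

  projY : Vtx Y → Vertex → Vtx Y
  projY d (inj₁ x) with GluedX? x
  ... | yes (s , _) = embed g s
  ... | no _ = d
  projY _ (inj₂ y) = y

  projY-glued : ∀ {d s} → S s → projY d (inj₁ (embed f s)) ≡ embed g s
  projY-glued {d} {s} Ss with GluedX? (embed f s)
  ... | yes (s' , _ , fs'≡fs) = cong (embed g) (injective f fs'≡fs)
  ... | no ¬glued = contradiction (s , Ss , refl) ¬glued

  someX : ∀ p → XSide p → Vtx X
  someX (inj₁ x) _ = x

  someY : ∀ p → YSide p → Vtx Y
  someY (inj₁ _) (s , _) = embed g s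
  someY (inj₂ y) _ = y

  glued-X-vertex : ∀ {p} → XSide p → YSide p → Σ (Vtx Q) λ s → S s × p ≡ inj₁ (embed f s)
  glued-X-vertex {inj₁ _} _ (s , Ss , refl) = s , Ss , refl

  X-only : ∀ {d p} → XSide p → ¬ YSide p → ¬ GluedX (projX d p)
  X-only {p = inj₁ _} _ ¬Y = ¬Y

  projX-hom : ∀ {d p q} → XSide p → XSide q → Link p q → Adj X (projX d p) (projX d q)
  projX-hom {p = inj₁ _} {inj₁ _} _ _ l = l

  projX-injective : ∀ {d p q} → XSide p → XSide q → projX d p ≡ projX d q → p ≡ q
  projX-injective {p = inj₁ _} {inj₁ _} _ _ = cong inj₁

  projY-hom : ∀ {d p q} → YSide p → YSide q → Link p q → Adj Y (projY d p) (projY d q)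
  projY-hom {d} {inj₁ _} {inj₁ _} (s , Ss , refl) (s' , Ss' , refl) l =
    subst₂ (Adj Y) (sym (projY-glued Ss)) (sym (projY-glued Ss')) (Adj-embed g {s} {s'} (Adj-embed⁻ f {s} {s'} l))
  projY-hom {d} {inj₁ _} {inj₂ y} _ _ (s , Ss , refl , _ , a) = subst (λ z → Adj Y z y) (sym (projY-glued Ss)) a
  projY-hom {d} {inj₂ y} {inj₁ _} _ _ (s , Ss , refl , _ , a) =
    subst (Adj Y y) (sym (projY-glued Ss)) (Adj-sym Y {embed g s} {y} a)
  projY-hom {d} {inj₂ _} {inj₂ _} _ _ (_ , _ , a) = a

  projY-injective : ∀ {d p q} → YSide p → YSide q → projY d p ≡ projY d q → p ≡ q
  projY-injective {d} {inj₁ _} {inj₁ _} (s , Ss , refl) (s' , Ss' , refl) eq =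
    cong (λ t → inj₁ (embed f t)) (injective g (trans (sym (projY-glued Ss)) (trans eq (projY-glued Ss'))))
  projY-injective {d} {inj₁ _} {inj₂ y} (s , Ss , refl) ly eq = contradiction (s , Ss , trans (sym (projY-glued Ss)) eq) ly
  projY-injective {d} {inj₂ y} {inj₁ _} ly (s , Ss , refl) eq = contradiction (s , Ss , sym (trans eq (projY-glued Ss))) ly
  projY-injective {d} {inj₂ _} {inj₂ _} _ _ = cong inj₂

  module _ (acyclicX : Acyclic X) (acyclicY : Acyclic Y)
           (S-connected : ∀ {s t} → S s → S t → Walk (Adj Q) S s t) where

    open Gluing W {A = λ i → XSide (from i)} {B = λ i → YSide (from i)} (λ i → XSide? (from i)) (λ i → YSide? (from i))
                (λ {i} {j} a → Link-side {from i} {from j} (Adj⇒Link a))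

    toX : Vtx X → Vtx W → Vtx X
    toX d i = projX d (from i)

    toX-hom : ∀ {d u v} → XSide (from u) → XSide (from v) → Adj W u v → Adj X (toX d u) (toX d v)
    toX-hom {u = u} {v} Xu Xv a = projX-hom Xu Xv (Adj⇒Link {u} {v} a)

    toX-injective : ∀ {d u v} → XSide (from u) → XSide (from v) → toX d u ≡ toX d v → u ≡ v
    toX-injective Xu Xv eq = from-injective (projX-injective Xu Xv eq)

    no-ray-in-X : ∀ (R : PeriodicRay W) → (∀ i → XSide (from (ray R i))) → ⊥
    no-ray-in-X R on-X = ray-reflect {H = X} acyclicX R on-X (toX (someX (from (ray R 0)) (on-X 0))) toX-hom toX-injective

    no-ray-in-Y : ∀ (R : PeriodicRay W) → (∀ i → YSide (from (ray R i))) → ⊥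
    no-ray-in-Y R on-Y = ray-reflect {H = Y} acyclicY R on-Y (λ i → projY y₀ (from i))
                           (λ {u} {v} Yu Yv a → projY-hom Yu Yv (Adj⇒Link {u} {v} a))
                           (λ Yu Yv eq → from-injective (projY-injective Yu Yv eq))
      where
      y₀ : Vtx Y
      y₀ = someY (from (ray R 0)) (on-Y 0)

    -- The bridge runs through X from f(s) to f(t) for glued s, t; closing it up along a
    -- non-backtracking path from t to s inside S gives a cycle in X.
    no-bridge : ∀ R → Bridge R → ⊥
    no-bridge R bridge with glued-X-vertex (Bridge.start-A bridge) (Bridge.start-B bridge)
                          | glued-X-vertex (Bridge.end-A bridge) (Bridge.end-B bridge)
    ... | s , Ss , start≡ | t , St , end≡ =
      Acyclic⇒noClosedWalk {X} acyclicX (arc ++ʷ path) (++ʷ-nonBacktracking arc path arc-nb path-nb junction)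
        (≤-trans (s≤s z≤n) (≤-trans long (m≤m+n span (len U)))) refl
      where
      open Bridge bridge

      on-X : ∀ k → k ≤ span → XSide (from (ray R (start + k)))
      on-X zero _ = subst (λ z → XSide (from (ray R z))) (sym (+-identityʳ start)) start-A
      on-X (suc k) sk≤ with suc k ≟ span
      ... | yes refl = end-A
      ... | no sk≢ = proj₁ (interior (s≤s z≤n) (≤∧≢⇒< sk≤ sk≢))

      piece : Walk (Adj W) (λ i → XSide (from i)) (ray R start) (ray R (start + span))
      piece = raySegment R {λ i → XSide (from i)} start span on-X

      arc : Walk (Adj X) (λ _ → ⊤) (embed f s) (embed f t)
      arc = retarget (cong (projX (embed f s)) start≡) (cong (projX (embed f s)) end≡)
              (mapWalk (toX (embed f s)) toX-hom _ piece)

      arc-nb : NonBacktracking arc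
      arc-nb = mapWalk-nonBacktracking {R′ = Adj X} {P′ = λ _ → ⊤} (toX (embed f s)) toX-hom _ toX-injective
                 piece (raySegment-nonBacktracking R {λ i → XSide (from i)} start span on-X)

      reduced : Σ (Walk (Adj Q) S t s) NonBacktracking
      reduced = removeBacktracks _≟ᶠ_ (S-connected St Ss)

      U : Walk (Adj Q) S t s
      U = proj₁ reduced

      f-hom : ∀ {u v} → S u → S v → Adj Q u v → Adj X (embed f u) (embed f v)
      f-hom {u} {v} _ _ = Adj-embed f {u} {v}

      path : Walk (Adj X) (λ _ → ⊤) (embed f t) (embed f s)
      path = mapWalk (embed f) f-hom _ U

      path-nb : NonBacktracking path
      path-nb = mapWalk-nonBacktracking {R′ = Adj X} {P′ = λ _ → ⊤} (embed f) f-hom _ (λ _ _ → injective f) U (proj₂ reduced)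

      junction : 0 < span → 0 < len U → at arc (span ∸ 1) ≢ at path 1
      junction _ 0<len eq = X-only (proj₁ last-inside) (proj₂ last-inside) (subst GluedX (sym eq) (at U 1 , within U 1 0<len , refl))
        where
        last-inside : XSide (from (ray R (start + (span ∸ 1)))) × ¬ YSide (from (ray R (start + (span ∸ 1))))
        last-inside = interior (∸-monoˡ-≤ 1 long) (∸-monoʳ-< {span} {1} {0} (s≤s z≤n) (≤-trans (s≤s z≤n) long))

    W-acyclic : Acyclic W
    W-acyclic = glued-acyclic no-ray-in-X no-ray-in-Y no-bridge

  module _ (nabX : NoAdjacentBranching X) (nabY : NoAdjacentBranching Y)
           (branching-or-saturated : ∀ {s} → S s → 3 ≤ degree Q s ⊎ Saturated Q S s) where

    X-only-neighbour : ∀ {x p} → ¬ GluedX x → Link (inj₁ x) p → Σ (Vtx X) λ x' → p ≡ inj₁ x' × Adj X x x'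
    X-only-neighbour {p = inj₁ x'} _ a = x' , refl , a
    X-only-neighbour {p = inj₂ _} ¬glued (s , Ss , fs≡x , _) = contradiction (s , Ss , fs≡x) ¬glued

    degree-X-only : ∀ {x} → ¬ GluedX x → degree W (to (inj₁ x)) ≤ degree X x
    degree-X-only {x} ¬glued = degree-≤-degree W X (λ i → projX x (from i)) hom inj
      where
      hom : ∀ {i} → Adj W (to (inj₁ x)) i → Adj X x (projX x (from i))
      hom {i} a with x' , eq , xx' ← X-only-neighbour ¬glued (Adj-toˡ⇒Link {inj₁ x} {i} a) =
        subst (λ p → Adj X x (projX x p)) (sym eq) xx'
      inj : ∀ {i j} → Adj W (to (inj₁ x)) i → Adj W (to (inj₁ x)) j → projX x (from i) ≡ projX x (from j) → i ≡ j
      inj {i} {j} ai aj eq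
        with x₁ , eq₁ , _ ← X-only-neighbour ¬glued (Adj-toˡ⇒Link {inj₁ x} {i} ai)
           | x₂ , eq₂ , _ ← X-only-neighbour ¬glued (Adj-toˡ⇒Link {inj₁ x} {j} aj) =
        from-injective (projX-injective (subst XSide (sym eq₁) tt) (subst XSide (sym eq₂) tt) eq)

    degree-live : ∀ {y} → Live y → degree W (to (inj₂ y)) ≤ degree Y y
    degree-live {y} ly = degree-≤-degree W Y (λ i → projY y (from i)) hom inj
      where
      Y-neighbour : ∀ {p} → Link (inj₂ y) p → YSide p
      Y-neighbour {p} l with Link-side {inj₂ y} {p} l
      ... | inj₂ (_ , Yp) = Yp
      hom : ∀ {i} → Adj W (to (inj₂ y)) i → Adj Y y (projY y (from i))
      hom {i} a = projY-hom {y} {inj₂ y} ly (Y-neighbour l) l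
        where
        l : Link (inj₂ y) (from i)
        l = Adj-toˡ⇒Link {inj₂ y} {i} a
      inj : ∀ {i j} → Adj W (to (inj₂ y)) i → Adj W (to (inj₂ y)) j → projY y (from i) ≡ projY y (from j) → i ≡ j
      inj {i} {j} ai aj eq = from-injective (projY-injective (Y-neighbour (Adj-toˡ⇒Link {inj₂ y} {i} ai))
                                                             (Y-neighbour (Adj-toˡ⇒Link {inj₂ y} {j} aj)) eq)

    degree-saturated : ∀ {s} → Saturated Q S s → degree W (to (inj₁ (embed f s))) ≤ 2
    degree-saturated {s} sat = degree-to-≤ (inj₁ (embed f glued₁) ∷ inj₁ (embed f glued₂) ∷ []) neighbour
      where
      open Saturated sat
      neighbour : ∀ {p} → Link (inj₁ (embed f s)) p → p ∈ (inj₁ (embed f glued₁) ∷ inj₁ (embed f glued₂) ∷ [])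
      neighbour {inj₁ x} a with saturated-neighbour nabX f sat a
      ... | inj₁ refl = here refl
      ... | inj₂ refl = there (here refl)
      neighbour {inj₂ y} (t , _ , ft≡fs , ly , a) with saturated-neighbour nabY g sat (subst (λ z → Adj Y (embed g z) y) (injective f ft≡fs) a)
      ... | inj₁ refl = contradiction (glued₁ , S₁ , refl) ly
      ... | inj₂ refl = contradiction (glued₂ , S₂ , refl) ly

    branching-glued : ∀ {s} → S s → 2 < degree W (to (inj₁ (embed f s))) → 3 ≤ degree Q s
    branching-glued Ss deg with branching-or-saturated Ss
    ... | inj₁ 3≤ = 3≤
    ... | inj₂ sat = contradiction (degree-saturated sat) (<⇒≱ deg)

    branching-X : ∀ {x} → 2 < degree W (to (inj₁ x)) → 2 < degree X x
    branching-X {x} deg with GluedX? x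
    ... | yes (s , Ss , refl) = ≤-trans (branching-glued Ss deg) (degree-≤-embed f s)
    ... | no ¬glued = ≤-trans deg (degree-X-only ¬glued)

    no-adjacent-branching : ∀ p q → Link p q → 2 < degree W (to p) → 2 < degree W (to q) → ⊥
    no-adjacent-branching (inj₁ x) (inj₁ x') a dp dq = nabX x x' a (branching-X dp) (branching-X dq)
    no-adjacent-branching (inj₁ _) (inj₂ y) (s , Ss , refl , ly , a) dp dq =
      nabY (embed g s) y a (≤-trans (branching-glued Ss dp) (degree-≤-embed g s)) (≤-trans dq (degree-live ly))
    no-adjacent-branching (inj₂ y) (inj₁ _) (s , Ss , refl , ly , a) dp dq =
      nabY (embed g s) y a (≤-trans (branching-glued Ss dq) (degree-≤-embed g s)) (≤-trans dp (degree-live ly))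
    no-adjacent-branching (inj₂ y) (inj₂ y') (ly , ly' , a) dp dq =
      nabY y y' a (≤-trans dp (degree-live ly)) (≤-trans dq (degree-live ly'))

    W-noAdjacentBranching : NoAdjacentBranching W
    W-noAdjacentBranching i j a di dj =
      no-adjacent-branching (from i) (from j) (Adj⇒Link {i} {j} a)
        (subst (2 <_) (sym (degree-from i)) di) (subst (2 <_) (sym (degree-from j)) dj)

amalgamate : ∀ {Q X Y : Graph} (f : Embedding Q X) (g : Embedding Q Y) {S : Vtx Q → Set} → (∀ s → Dec (S s)) →
             (∀ {s t} → S s → S t → Walk (Adj Q) S s t) →
             (∀ {s} → S s → 3 ≤ degree Q s ⊎ Saturated Q S s) →
             InG X → InG Y →
             Σ Graph λ W → InG W × Σ (Embedding X W) λ f′ → Σ (Embedding Y W) λ g′ →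
               ∀ {s} → S s → embed f′ (embed f s) ≡ embed g′ (embed g s)
amalgamate f g S? S-connected branching-or-saturated (acyclicX , nabX) (acyclicY , nabY) =
  W , (W-acyclic acyclicX acyclicY S-connected , W-noAdjacentBranching nabX nabY branching-or-saturated) ,
  f′ , g′ , f′-g′-agree
  where open Amalgamation f g S?

-- The extension Z′ of Z

_⊕_ : ∀ {A B : Set} {m k} → A ↔ Fin m → B ↔ Fin k → (A ⊎ B) ↔ Fin (m + k)
p ⊕ q = ↔-trans (p ⊎-↔ q) (↔-sym +↔⊎)
infixr 4 _⊕_

-- The summands are: the vertices of Z, three leaves for each centre, the extra neighbour of each
-- pendant vertex, its two leaves, the connector of each root, the hub, and the three leaves of the hub.
Vertex′ : ℕ → Set
Vertex′ n = Fin n ⊎ (Fin 3 × Fin n) ⊎ Fin n ⊎ (Fin 2 × Fin n) ⊎ Fin n ⊎ ⊤ ⊎ Fin 3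

pattern base a          = inj₁ a
pattern leaf k a        = inj₂ (inj₁ (k , a))
pattern pendant a       = inj₂ (inj₂ (inj₁ a))
pattern pendantLeaf k a = inj₂ (inj₂ (inj₂ (inj₁ (k , a))))
pattern connector a     = inj₂ (inj₂ (inj₂ (inj₂ (inj₁ a))))
pattern hub             = inj₂ (inj₂ (inj₂ (inj₂ (inj₂ (inj₁ tt)))))
pattern hubLeaf k       = inj₂ (inj₂ (inj₂ (inj₂ (inj₂ (inj₂ k)))))

Vertex′↔Fin : ∀ n → Vertex′ n ↔ Fin (n + (3 * n + (n + (2 * n + (n + (1 + 3))))))
Vertex′↔Fin n = ↔-refl ⊕ ↔-sym *↔× ⊕ ↔-refl ⊕ ↔-sym *↔× ⊕ ↔-refl ⊕ ↔-sym 1↔⊤ ⊕ ↔-refl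

module Extension (Z : Graph) (Z∈𝒢 : InG Z) where

  private
    n : ℕ
    n = size Z
    acyclicZ : Acyclic Z
    acyclicZ = proj₁ Z∈𝒢
    nabZ : NoAdjacentBranching Z
    nabZ = proj₂ Z∈𝒢

  open MaximalIndependentExtension
    (maximalIndependentExtension Z (λ v → 3 ≤? degree Z v) (λ {u} {v} du dv a → nabZ u v a du dv))
    renaming (member to Centre; member? to Centre?; extends to branching⇒Centre;
              independent to centres-independent; dominating to centres-dominate)

  open Representatives Z acyclicZ Centre? using (IsRoot; IsRoot?; walk-to-root; roots-equal)

  ¬Centre⇒degree≤2 : ∀ {a} → ¬ Centre a → degree Z a ≤ 2
  ¬Centre⇒degree≤2 {a} ¬centre with degree Z a ≤? 2
  ... | yes ≤2 = ≤2
  ... | no ≰2 = contradiction (branching⇒Centre (≰⇒> ≰2)) ¬centre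

  Pendant : Vtx Z → Set
  Pendant a = ¬ Centre a × degree Z a ≡ 1

  Pendant? : ∀ a → Dec (Pendant a)
  Pendant? a = ¬? (Centre? a) ×-dec (degree Z a ≟ 1)

  V′ : Set
  V′ = Vertex′ n

  _≟′_ : (u v : V′) → Dec (u ≡ v)
  _≟′_ = inj⇒≟ (↔⇒↣ (Vertex′↔Fin n))

  data Edge : V′ → V′ → Set where
    base-base           : ∀ {a b} → Adj Z a b → Edge (base a) (base b)
    leaf-base           : ∀ {k a} → Centre a → Edge (leaf k a) (base a)
    pendant-base        : ∀ {a} → Pendant a → Edge (pendant a) (base a)
    pendantLeaf-pendant : ∀ {k a} → Pendant a → Edge (pendantLeaf k a) (pendant a)
    connector-base      : ∀ {a} → IsRoot a → Edge (connector a) (base a)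
    connector-hub       : ∀ {a} → IsRoot a → Edge (connector a) hub
    hubLeaf-hub         : ∀ {k} → Edge (hubLeaf k) hub

  edge? : ∀ u v → Dec (Edge u v)
  edge? (base a) (base b) = map′ base-base (λ { (base-base e) → e }) (Adj? Z a b)
  edge? (base _) (leaf _ _) = no λ ()
  edge? (base _) (pendant _) = no λ ()
  edge? (base _) (pendantLeaf _ _) = no λ ()
  edge? (base _) (connector _) = no λ ()
  edge? (base _) hub = no λ ()
  edge? (base _) (hubLeaf _) = no λ ()
  edge? (leaf k a) v = map′ (λ { (refl , c) → leaf-base c }) (λ { (leaf-base c) → refl , c }) ((v ≟′ base a) ×-dec Centre? a)
  edge? (pendant a) v = map′ (λ { (refl , p) → pendant-base p }) (λ { (pendant-base p) → refl , p }) ((v ≟′ base a) ×-dec Pendant? a)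
  edge? (pendantLeaf k a) v =
    map′ (λ { (refl , p) → pendantLeaf-pendant p }) (λ { (pendantLeaf-pendant p) → refl , p }) ((v ≟′ pendant a) ×-dec Pendant? a)
  edge? (connector a) v =
    map′ (λ { (inj₁ refl , r) → connector-base r ; (inj₂ refl , r) → connector-hub r })
         (λ { (connector-base r) → inj₁ refl , r ; (connector-hub r) → inj₂ refl , r })
         (((v ≟′ base a) ⊎-dec (v ≟′ hub)) ×-dec IsRoot? a)
  edge? hub v = no λ ()
  edge? (hubLeaf k) v = map′ (λ { refl → hubLeaf-hub }) (λ { hubLeaf-hub → refl }) (v ≟′ hub)

  Link : V′ → V′ → Set
  Link u v = Edge u v ⊎ Edge v u

  link? : ∀ u v → Dec (Link u v)
  link? u v = edge? u v ⊎-dec edge? v u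

  link-sym : ∀ {u v} → Link u v → Link v u
  link-sym (inj₁ e) = inj₂ e
  link-sym (inj₂ e) = inj₁ e

  link-irrefl : ∀ {u} → ¬ Link u u
  link-irrefl (inj₁ (base-base e)) = Adj-irrefl Z e
  link-irrefl (inj₂ (base-base e)) = Adj-irrefl Z e

  open CodedGraph (Vertex′↔Fin n) link? link-sym link-irrefl

  Z′ : Graph
  Z′ = graph

  ι : Embedding Z Z′
  ι = record
    { map = λ a → to (base a)
    ; injective = λ eq → base-injective (to-injective eq)
    ; preserves = λ a b → adj-to (λ { (inj₁ (base-base e)) → e ; (inj₂ (base-base e)) → Adj-sym Z e }) (λ e → inj₁ (base-base e)) }
    where
    base-injective : ∀ {a b} → base a ≡ base b → a ≡ b
    base-injective refl = refl

  Branches : V′ → Set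
  Branches (base a) = Centre a
  Branches (pendant a) = Pendant a
  Branches hub = ⊤
  Branches _ = ⊥

  Branches? : ∀ u → Dec (Branches u)
  Branches? (base a) = Centre? a
  Branches? (leaf _ _) = no λ ()
  Branches? (pendant a) = Pendant? a
  Branches? (pendantLeaf _ _) = no λ ()
  Branches? (connector _) = no λ ()
  Branches? hub = yes tt
  Branches? (hubLeaf _) = no λ ()

  branches⇒3≤degree : ∀ {u} → Branches u → 3 ≤ degree Z′ (to u)
  branches⇒3≤degree {base a} c =
    3≤degree-to (inj₂ (leaf-base {0F} c)) (inj₂ (leaf-base {1F} c)) (inj₂ (leaf-base {2F} c))
      (λ ()) (λ ()) (λ ())
  branches⇒3≤degree {pendant a} p =
    3≤degree-to (inj₁ (pendant-base p)) (inj₂ (pendantLeaf-pendant {0F} p)) (inj₂ (pendantLeaf-pendant {1F} p))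
      (λ ()) (λ ()) (λ ())
  branches⇒3≤degree {hub} _ =
    3≤degree-to (inj₂ (hubLeaf-hub {0F})) (inj₂ (hubLeaf-hub {1F})) (inj₂ (hubLeaf-hub {2F}))
      (λ ()) (λ ()) (λ ())

  -- A non-centre of Z has Z-degree ≤ 2, and it only gains the extra vertex when it is pendant.
  ¬branches⇒degree≤2 : ∀ {u} → ¬ Branches u → degree Z′ (to u) ≤ 2
  ¬branches⇒degree≤2 {base a} ¬centre with Pendant? a
  ... | yes (_ , degree≡1) = ≤-trans (degree-to-≤ {base a} (pendant a ∷ map base (neighbours Z a)) neighbour)
                                     (≤-reflexive (cong suc (trans (length-map base (neighbours Z a)) degree≡1)))
    where
    neighbour : ∀ {v} → Link (base a) v → v ∈ pendant a ∷ map base (neighbours Z a)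
    neighbour (inj₁ (base-base e)) = there (∈-map⁺ base (∈-neighbours⁺ Z e))
    neighbour {base b} (inj₂ (base-base e)) = there (∈-map⁺ base (∈-neighbours⁺ Z (Adj-sym Z {b} {a} e)))
    neighbour (inj₂ (leaf-base c)) = contradiction c ¬centre
    neighbour (inj₂ (pendant-base _)) = here refl
    neighbour (inj₂ (connector-base r)) = contradiction (proj₁ r) ¬centre
  ... | no ¬pendant = ≤-trans (degree-to-≤ {base a} (map base (neighbours Z a)) neighbour)
                              (≤-trans (≤-reflexive (length-map base (neighbours Z a))) (¬Centre⇒degree≤2 ¬centre))
    where
    neighbour : ∀ {v} → Link (base a) v → v ∈ map base (neighbours Z a)
    neighbour (inj₁ (base-base e)) = ∈-map⁺ base (∈-neighbours⁺ Z e)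
    neighbour {base b} (inj₂ (base-base e)) = ∈-map⁺ base (∈-neighbours⁺ Z (Adj-sym Z {b} {a} e))
    neighbour (inj₂ (leaf-base c)) = contradiction c ¬centre
    neighbour (inj₂ (pendant-base p)) = contradiction p ¬pendant
    neighbour (inj₂ (connector-base r)) = contradiction (proj₁ r) ¬centre
  ¬branches⇒degree≤2 {leaf k a} _ =
    ≤-trans (degree-to-≤ {leaf k a} (base a ∷ []) λ { (inj₁ (leaf-base _)) → here refl ; (inj₂ ()) }) (s≤s z≤n)
  ¬branches⇒degree≤2 {pendant a} ¬pendant = ≤-trans (degree-to-≤ {pendant a} [] neighbour) z≤n
    where
    neighbour : ∀ {v} → Link (pendant a) v → v ∈ []
    neighbour (inj₁ (pendant-base p)) = contradiction p ¬pendant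
    neighbour (inj₂ (pendantLeaf-pendant p)) = contradiction p ¬pendant
  ¬branches⇒degree≤2 {pendantLeaf k a} _ =
    ≤-trans (degree-to-≤ {pendantLeaf k a} (pendant a ∷ []) λ { (inj₁ (pendantLeaf-pendant _)) → here refl ; (inj₂ ()) }) (s≤s z≤n)
  ¬branches⇒degree≤2 {connector a} _ =
    degree-to-≤ {connector a} (base a ∷ hub ∷ []) λ { (inj₁ (connector-base _)) → here refl ; (inj₁ (connector-hub _)) → there (here refl) ; (inj₂ ()) }
  ¬branches⇒degree≤2 {hub} ¬branches = contradiction tt ¬branches
  ¬branches⇒degree≤2 {hubLeaf k} _ = ≤-trans (degree-to-≤ {hubLeaf k} (hub ∷ []) λ { (inj₁ hubLeaf-hub) → here refl ; (inj₂ ()) }) (s≤s z≤n)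

  branches-independent : ∀ {u v} → Branches u → Branches v → ¬ Edge u v
  branches-independent cu cv (base-base e) = centres-independent cu cv e
  branches-independent (¬centre , _) centre (pendant-base _) = ¬centre centre
  branches-independent () _ (leaf-base _)
  branches-independent () _ (pendantLeaf-pendant _)
  branches-independent () _ (connector-base _)
  branches-independent () _ (connector-hub _)
  branches-independent () _ hubLeaf-hub

  Z′-noAdjacentBranching : NoAdjacentBranching Z′
  Z′-noAdjacentBranching i j a di dj with Branches? (from i) | Branches? (from j) | Adj⇒Link {i} {j} a
  ... | no ¬b | _ | _ = <⇒≱ di (subst (_≤ 2) (degree-from i) (¬branches⇒degree≤2 {from i} ¬b))
  ... | yes _ | no ¬b | _ = <⇒≱ dj (subst (_≤ 2) (degree-from j) (¬branches⇒degree≤2 {from j} ¬b))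
  ... | yes bi | yes bj | inj₁ e = branches-independent bi bj e
  ... | yes bi | yes bj | inj₂ e = branches-independent bj bi e

  Glued : V′ → Set
  Glued (base _) = ⊤
  Glued (pendant a) = Pendant a
  Glued (connector a) = IsRoot a
  Glued hub = ⊤
  Glued _ = ⊥

  Glued? : ∀ u → Dec (Glued u)
  Glued? (base _) = yes tt
  Glued? (leaf _ _) = no λ ()
  Glued? (pendant a) = Pendant? a
  Glued? (pendantLeaf _ _) = no λ ()
  Glued? (connector a) = IsRoot? a
  Glued? hub = yes tt
  Glued? (hubLeaf _) = no λ ()

  S : Vtx Z′ → Set
  S i = Glued (from i)

  S? : ∀ i → Dec (S i)
  S? i = Glued? (from i)

  S-to : ∀ {u} → Glued u → S (to u)
  S-to {u} = subst Glued (sym (strictlyInverseʳ u))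

  saturated : ∀ {u x y t} → Link u x → Link u y → x ≢ y → Glued x → Glued y → Link u t → Branches t →
              Saturated Z′ S (to u)
  saturated {u} {x} {y} {t} ux uy x≢y Gx Gy ut Bt = record
    { glued₁ = to x ; glued₂ = to y ; branch = to t ; adj₁ = Link⇒Adj ux ; adj₂ = Link⇒Adj uy
    ; distinct = λ eq → x≢y (to-injective eq) ; S₁ = S-to Gx ; S₂ = S-to Gy
    ; adj-branch = Link⇒Adj ut ; branching = branches⇒3≤degree {t} Bt }

  degree≡2 : ∀ {a c} → ¬ Centre a → ¬ Pendant a → Adj Z a c → degree Z a ≡ 2
  degree≡2 {a} {c} ¬centre ¬pendant ac = ≤-antisym (¬Centre⇒degree≤2 ¬centre) 2≤
    where
    1≤ : 1 ≤ degree Z a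
    1≤ = length-≤-degree Z (c ∷ []) ([] ∷ []) λ { (here refl) → ac }
    2≤ : 2 ≤ degree Z a
    2≤ with m≤n⇒m<n∨m≡n 1≤
    ... | inj₁ 1< = 1<
    ... | inj₂ 1≡ = contradiction (¬centre , sym 1≡) ¬pendant

  -- A non-centre of Z is next to a centre; its two glued neighbours are its two Z-neighbours,
  -- or its only Z-neighbour and the extra pendant vertex.
  non-centre-saturated : ∀ {a c} → ¬ Centre a → Adj Z a c → Centre c → Saturated Z′ S (to (base a))
  non-centre-saturated {a} ¬centre ac centre-c with Pendant? a
  ... | yes p = saturated (inj₁ (base-base ac)) (inj₂ (pendant-base p)) (λ ()) tt p (inj₁ (base-base ac)) centre-c
  ... | no ¬p with x , y , x≢y , x∈ , y∈ ← two-elements (degree≡2 ¬centre ¬p ac) (neighbours-unique Z a) =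
    saturated (inj₁ (base-base (∈-neighbours⁻ Z x∈))) (inj₁ (base-base (∈-neighbours⁻ Z y∈)))
              (λ { refl → x≢y refl }) tt tt (inj₁ (base-base ac)) centre-c

  glued-saturation : ∀ {u} → Glued u → 3 ≤ degree Z′ (to u) ⊎ Saturated Z′ S (to u)
  glued-saturation {base a} _ with Centre? a
  ... | yes centre = inj₁ (branches⇒3≤degree {base a} centre)
  ... | no ¬centre = let c , ac , centre-c = centres-dominate ¬centre in inj₂ (non-centre-saturated ¬centre ac centre-c)
  glued-saturation {pendant a} p = inj₁ (branches⇒3≤degree {pendant a} p)
  glued-saturation {connector a} r =
    inj₂ (saturated (inj₁ (connector-base r)) (inj₁ (connector-hub r)) (λ ()) tt tt (inj₁ (connector-hub r)) tt)
  glued-saturation {hub} _ = inj₁ (branches⇒3≤degree {hub} tt)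

  S-branching-or-saturated : ∀ {i} → S i → 3 ≤ degree Z′ i ⊎ Saturated Z′ S i
  S-branching-or-saturated {i} Si =
    subst (λ j → 3 ≤ degree Z′ j ⊎ Saturated Z′ S j) (strictlyInverseˡ i) (glued-saturation {from i} Si)

  base-walk : ∀ {P : Vtx Z → Set} {a b} → Walk (Adj Z) P a b → Walk Link Glued (base a) (base b)
  base-walk = mapWalk base (λ _ _ e → inj₁ (base-base e)) (λ _ → tt)

  near-centre : ∀ a → Σ (Vtx Z) λ c → Centre c × Walk Link Glued (base a) (base c)
  near-centre a with Centre? a
  ... | yes centre = a , centre , stay tt
  ... | no ¬centre with c , ac , centre-c ← centres-dominate ¬centre = c , centre-c , hop tt tt (inj₁ (base-base ac))

  to-hub : ∀ {u} → Glued u → Walk Link Glued u hub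
  to-hub {base a} _ with c , centre-c , W₁ ← near-centre a with r , root , W₂ ← walk-to-root centre-c =
    W₁ ++ʷ (base-walk W₂ ++ʷ (hop tt root (inj₂ (connector-base root)) ++ʷ hop root tt (inj₁ (connector-hub root))))
  to-hub {pendant a} p = hop p tt (inj₁ (pendant-base p)) ++ʷ to-hub {base a} tt
  to-hub {connector a} r = hop r tt (inj₁ (connector-hub r))
  to-hub {hub} _ = stay tt

  S-connected : ∀ {i j} → S i → S j → Walk (Adj Z′) S i j
  S-connected {i} {j} Si Sj =
    retarget (strictlyInverseˡ i) (strictlyInverseˡ j)
      (mapWalk to (λ _ _ l → Link⇒Adj l) S-to (to-hub Si ++ʷ reverse link-sym (to-hub Sj)))

  Core : V′ → Set
  Core hub = ⊥
  Core (hubLeaf _) = ⊥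
  Core _ = ⊤

  Core? : ∀ u → Dec (Core u)
  Core? (base _) = yes tt
  Core? (leaf _ _) = yes tt
  Core? (pendant _) = yes tt
  Core? (pendantLeaf _ _) = yes tt
  Core? (connector _) = yes tt
  Core? hub = no λ ()
  Core? (hubLeaf _) = no λ ()

  Star : V′ → Set
  Star (connector _) = ⊤
  Star hub = ⊤
  Star (hubLeaf _) = ⊤
  Star _ = ⊥

  Star? : ∀ u → Dec (Star u)
  Star? (base _) = no λ ()
  Star? (leaf _ _) = no λ ()
  Star? (pendant _) = no λ ()
  Star? (pendantLeaf _ _) = no λ ()
  Star? (connector _) = yes tt
  Star? hub = yes tt
  Star? (hubLeaf _) = yes tt

  edge-side : ∀ {u v} → Edge u v → (Core u × Core v) ⊎ (Star u × Star v)
  edge-side (base-base _) = inj₁ (tt , tt)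
  edge-side (leaf-base _) = inj₁ (tt , tt)
  edge-side (pendant-base _) = inj₁ (tt , tt)
  edge-side (pendantLeaf-pendant _) = inj₁ (tt , tt)
  edge-side (connector-base _) = inj₁ (tt , tt)
  edge-side (connector-hub _) = inj₂ (tt , tt)
  edge-side hubLeaf-hub = inj₂ (tt , tt)

  link-side : ∀ {u v} → Link u v → (Core u × Core v) ⊎ (Star u × Star v)
  link-side (inj₁ e) = edge-side e
  link-side (inj₂ e) with edge-side e
  ... | inj₁ (Cv , Cu) = inj₁ (Cu , Cv)
  ... | inj₂ (Sv , Su) = inj₂ (Su , Sv)

  BaseVertex : V′ → Set
  BaseVertex u = Σ (Vtx Z) λ a → u ≡ base a

  baseOf : Vtx Z → V′ → Vtx Z
  baseOf _ (base a) = a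
  baseOf d _ = d

  baseOf-hom : ∀ {d u v} → BaseVertex u → BaseVertex v → Link u v → Adj Z (baseOf d u) (baseOf d v)
  baseOf-hom (a , refl) (b , refl) (inj₁ (base-base e)) = e
  baseOf-hom (a , refl) (b , refl) (inj₂ (base-base e)) = Adj-sym Z {b} {a} e

  baseOf-injective : ∀ {d u v} → BaseVertex u → BaseVertex v → baseOf d u ≡ baseOf d v → u ≡ v
  baseOf-injective (a , refl) (b , refl) = cong base

  connector-base-link : ∀ {a b} → Link (connector a) (base b) → IsRoot a × b ≡ a
  connector-base-link (inj₁ (connector-base r)) = r , refl

  core∩star : ∀ {u} → Core u → Star u → Σ (Vtx Z) λ a → u ≡ connector a
  core∩star {connector a} _ _ = a , refl
  core∩star {base _} _ ()
  core∩star {leaf _ _} _ ()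
  core∩star {pendant _} _ ()
  core∩star {pendantLeaf _ _} _ ()
  core∩star {hub} ()
  core∩star {hubLeaf _} ()

  module OnRay (R : PeriodicRay Z′) where

    ρ : ℕ → V′
    ρ i = from (ray R i)

    link-ρ : ∀ i → Link (ρ i) (ρ (suc i))
    link-ρ i = Adj⇒Link {ray R i} {ray R (suc i)} (ray-step R i)

    ρ-nonBacktracking : ∀ i → ρ i ≢ ρ (suc (suc i))
    ρ-nonBacktracking i eq = ray-nonBacktracking R i (from-injective eq)

    two-neighbours : ∀ i {c} → ¬ (∀ {k} → Link (ρ i) (ρ k) → ρ k ≡ c)
    two-neighbours i {c} only = ray-two-neighbours R i {to c} λ {k} a →
      trans (sym (strictlyInverseˡ (ray R k))) (cong to (only (Adj⇒Link {ray R i} {ray R k} a)))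

    -- Leaves have a single neighbour, and the pendant vertex then only one neighbour on the ray.
    ρ≢leaf : ∀ i {k a} → ρ i ≢ leaf k a
    ρ≢leaf i {k} {a} eq = two-neighbours i {base a} λ {j} l → only (subst (λ z → Link z (ρ j)) eq l)
      where
      only : ∀ {v} → Link (leaf k a) v → v ≡ base a
      only (inj₁ (leaf-base _)) = refl

    ρ≢pendantLeaf : ∀ i {k a} → ρ i ≢ pendantLeaf k a
    ρ≢pendantLeaf i {k} {a} eq = two-neighbours i {pendant a} λ {j} l → only (subst (λ z → Link z (ρ j)) eq l)
      where
      only : ∀ {v} → Link (pendantLeaf k a) v → v ≡ pendant a
      only (inj₁ (pendantLeaf-pendant _)) = refl

    ρ≢hubLeaf : ∀ i {k} → ρ i ≢ hubLeaf k
    ρ≢hubLeaf i {k} eq = two-neighbours i {hub} λ {j} l → only (subst (λ z → Link z (ρ j)) eq l)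
      where
      only : ∀ {v} → Link (hubLeaf k) v → v ≡ hub
      only (inj₁ hubLeaf-hub) = refl

    ρ≢pendant : ∀ i {a} → ρ i ≢ pendant a
    ρ≢pendant i {a} eq = two-neighbours i {base a} λ {j} l → only j (subst (λ z → Link z (ρ j)) eq l)
      where
      only : ∀ j → Link (pendant a) (ρ j) → ρ j ≡ base a
      only j l with ρ j | ρ≢pendantLeaf j
      only j (inj₁ (pendant-base _)) | _ | _ = refl
      only j (inj₂ (pendantLeaf-pendant _)) | _ | ≢leaf = contradiction refl ≢leaf

    core-base : ∀ i → Core (ρ i) → ¬ Star (ρ i) → BaseVertex (ρ i)
    core-base i with ρ i in eq
    ... | base a = λ _ _ → a , refl
    ... | leaf _ _ = λ _ _ → contradiction eq (ρ≢leaf i)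
    ... | pendant _ = λ _ _ → contradiction eq (ρ≢pendant i)
    ... | pendantLeaf _ _ = λ _ _ → contradiction eq (ρ≢pendantLeaf i)
    ... | connector _ = λ _ ¬star → contradiction tt ¬star
    ... | hub = λ ()
    ... | hubLeaf _ = λ ()

    ρ≢connector-on-core : (∀ i → Core (ρ i)) → ∀ i {a} → ρ i ≢ connector a
    ρ≢connector-on-core core i {a} eq = two-neighbours i {base a} λ {j} l → only j (subst (λ z → Link z (ρ j)) eq l)
      where
      only : ∀ j → Link (connector a) (ρ j) → ρ j ≡ base a
      only j l with ρ j | core j
      only j (inj₁ (connector-base _)) | _ | _ = refl
      only j (inj₁ (connector-hub _)) | _ | ()

    core-ray-base : (∀ i → Core (ρ i)) → ∀ i → BaseVertex (ρ i)
    core-ray-base core i with Star? (ρ i)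
    ... | no ¬star = core-base i (core i) ¬star
    ... | yes star = let a , eq = core∩star (core i) star in contradiction eq (ρ≢connector-on-core core i)

    star-ray-hub : (∀ i → Star (ρ i)) → ∀ i → ρ i ≡ hub
    star-ray-hub star i with ρ i in eq | star i
    ... | hub | _ = refl
    ... | hubLeaf _ | _ = contradiction eq (ρ≢hubLeaf i)
    ... | connector a | _ = contradiction (λ {j} l → only j (subst (λ z → Link z (ρ j)) eq l)) (two-neighbours i {hub})
      where
      only : ∀ j → Link (connector a) (ρ j) → ρ j ≡ hub
      only j l with ρ j | star j
      only j (inj₁ (connector-base _)) | _ | ()
      only j (inj₁ (connector-hub _)) | _ | _ = refl

    -- Between two consecutive visits to connectors the ray walks inside Z from one root to another.
    module RootToRoot (i e : ℕ) {a₁ a₂} (start≡ : ρ i ≡ connector a₁) (end≡ : ρ (suc (suc (i + e))) ≡ connector a₂)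
                      (inside : ∀ k → k ≤ e → BaseVertex (ρ (suc (i + k)))) where

      start-root : IsRoot a₁ × ρ (suc i) ≡ base a₁
      start-root with b , eq ← subst (λ z → BaseVertex (ρ (suc z))) (+-identityʳ i) (inside 0 z≤n)
        with root , refl ← connector-base-link (subst₂ Link start≡ eq (link-ρ i)) = root , eq

      end-root : IsRoot a₂ × ρ (suc (i + e)) ≡ base a₂
      end-root with b , eq ← inside e ≤-refl
        with root , refl ← connector-base-link (link-sym (subst₂ Link eq end≡ (link-ρ (suc (i + e))))) = root , eq

      path : Walk (Adj Z′) (λ j → BaseVertex (from j)) (ray R (suc i)) (ray R (suc i + e))
      path = raySegment R (suc i) e inside

      hom : ∀ {u v} → BaseVertex (from u) → BaseVertex (from v) → Adj Z′ u v → Adj Z (baseOf a₁ (from u)) (baseOf a₁ (from v))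
      hom {u} {v} bu bv a = baseOf-hom bu bv (Adj⇒Link {u} {v} a)

      walk : Walk (Adj Z) (λ _ → ⊤) a₁ a₂
      walk = retarget (cong (baseOf a₁) (proj₂ start-root)) (cong (baseOf a₁) (proj₂ end-root))
               (mapWalk {R′ = Adj Z} {P′ = λ _ → ⊤} (λ j → baseOf a₁ (from j)) hom _ path)

      walk-nb : NonBacktracking walk
      walk-nb = mapWalk-nonBacktracking {R′ = Adj Z} {P′ = λ _ → ⊤} (λ j → baseOf a₁ (from j)) hom _
                  (λ bu bv eq → from-injective (baseOf-injective bu bv eq)) path
                  (raySegment-nonBacktracking R {λ j → BaseVertex (from j)} (suc i) e inside)

      same-root : a₁ ≡ a₂
      same-root = roots-equal (proj₁ start-root) (proj₁ end-root) walk walk-nb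

      absurd : ⊥
      absurd = by-length e refl
        where
        by-length : ∀ e′ → e ≡ e′ → ⊥
        by-length zero refl = ρ-nonBacktracking i
          (trans start≡ (trans (cong connector same-root) (sym (subst (λ z → ρ (suc (suc z)) ≡ connector a₂) (+-identityʳ i) end≡))))
        by-length (suc _) refl = Acyclic⇒noClosedWalk {Z} acyclicZ walk walk-nb (s≤s z≤n) same-root

  open Gluing Z′ {A = λ i → Core (from i)} {B = λ i → Star (from i)} (λ i → Core? (from i)) (λ i → Star? (from i))
              (λ {i} {j} a → link-side (Adj⇒Link {i} {j} a))

  no-ray-in-Core : ∀ (R : PeriodicRay Z′) → (∀ i → Core (from (ray R i))) → ⊥
  no-ray-in-Core R core =
    ray-reflect {H = Z} acyclicZ R {λ j → BaseVertex (from j)} (core-ray-base core) (λ j → baseOf a₀ (from j))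
      (λ {u} {v} bu bv a → baseOf-hom bu bv (Adj⇒Link {u} {v} a)) (λ bu bv eq → from-injective (baseOf-injective bu bv eq))
    where
    open OnRay R
    a₀ : Vtx Z
    a₀ = proj₁ (core-ray-base core 0)

  no-ray-in-Star : ∀ (R : PeriodicRay Z′) → (∀ i → Star (from (ray R i))) → ⊥
  no-ray-in-Star R star = link-irrefl (subst₂ Link (star-ray-hub star 0) (star-ray-hub star 1) (link-ρ 0))
    where open OnRay R

  no-bridge : ∀ R → Bridge R → ⊥
  no-bridge R b with core∩star (Bridge.start-A b) (Bridge.start-B b) | core∩star (Bridge.end-A b) (Bridge.end-B b)
                   | m≤n⇒∃[o]m+o≡n (Bridge.long b)
  ... | a₁ , start≡ | a₂ , end≡ | e , refl =
    RootToRoot.absurd start e start≡ (subst (λ z → ρ z ≡ connector a₂) (trans (+-suc start (suc e)) (cong suc (+-suc start e))) end≡) inside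
    where
    open OnRay R
    open Bridge b
    inside : ∀ k → k ≤ e → BaseVertex (ρ (suc (start + k)))
    inside k k≤e = subst (λ z → BaseVertex (ρ z)) (+-suc start k)
                     (core-base (start + suc k) (proj₁ (interior (s≤s z≤n) (s≤s (s≤s k≤e)))) (proj₂ (interior (s≤s z≤n) (s≤s (s≤s k≤e)))))

  Z′-acyclic : Acyclic Z′
  Z′-acyclic = glued-acyclic no-ray-in-Core no-ray-in-Star no-bridge

  Z′∈𝒢 : InG Z′
  Z′∈𝒢 = Z′-acyclic , Z′-noAdjacentBranching

  ι-glued : ∀ a → S (embed ι a)
  ι-glued a = S-to {base a} tt

mainTheorem7 : WAP InG
mainTheorem7 Z Z∈𝒢 = Z′ , Z′∈𝒢 , ι , λ X Y X∈𝒢 Y∈𝒢 f g →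
  let W , W∈𝒢 , f′ , g′ , agree = amalgamate f g S? S-connected S-branching-or-saturated X∈𝒢 Y∈𝒢
  in W , W∈𝒢 , f′ , g′ , λ z → agree (ι-glued z)
  where open Extension Z Z∈𝒢
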